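{- Let $k\ge1$ and $n$ be integers and let $1\le s_1<s_2<\ldots<s_k<\frac{n}{2}$ be integers. Let $G=C_n(s_1,\ldots,s_k)$ be the circulant graph and $\widetilde{G}$ the cone over $G$. Then $Jac(\widetilde{G})$ is isomorphic to $\mathrm{coker}(\mathcal{A}^n-I)$, where $\mathcal{A}$ is the companion matrix of the Laurent polynomial $2k+1-\sum_{l=1}^{k}(z^{s_l}+z^{ -s_l})$ and $I$ is the identity matrix of the same size as $\mathcal{A}$.
   Context: The circulant graph $C_n(s_1,\ldots,s_k)$ has vertices $0,1,\ldots,n-1$, with vertex $i$ adjacent to $i\pm s_1,\ldots,i\pm s_k \pmod n$. The cone over a graph $G$ is obtained by adding a new vertex joined by a single edge to every vertex of $G$. For a connected graph $H$ on $m$ vertices with Laplacian $L(H)=D(H)-A(H)$ (degree matrix minus adjacency matrix), the Jacobian $Jac(H)$ is the torsion subgroup of $\mathbb{Z}^m/\mathrm{im}\,L(H)$. For a Laurent polynomial $Q(z)=c\,(z^{p}+a_1z^{p+1}+\ldots+a_{s-1}z^{p+s-1}+z^{p+s})$ with $c\in\{1,-1\}$, integers $p,a_i$ and $s>0$, its companion matrix is the $s\times s$ integer matrix whose first $s-1$ rows are $(0\mid I_{s-1})$ and whose last row is $(-1,-a_1,\ldots,-a_{s-1})$. For a square integer matrix $M$ of size $s$, $\mathrm{coker}\,M=\mathbb{Z}^s/\mathrm{im}\,M$. -}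

module Defs where

open import Data.Nat as ℕ using (ℕ; zero; suc; _%_; _≡ᵇ_; _<ᵇ_)
open import Data.Integer as ℤ using (ℤ; +_; -_; _+_; _-_; _*_)
open import Data.Fin using (Fin; zero; suc; toℕ)
open import Data.Bool using (Bool; true; false; if_then_else_; _∨_)
open import Data.Product using (Σ; ∃; _×_; _,_)
open import Relation.Binary.PropositionalEquality using (_≡_)
open import Relation.Nullary.Decidable using (⌊_⌋)

Vec : ℕ → Set
Vec m = Fin m → ℤ

Matrix : ℕ → ℕ → Set
Matrix m n = Fin m → Fin n → ℤ

sumFin : ∀ {n} → (Fin n → ℤ) → ℤ
sumFin {zero}  f = + 0
sumFin {suc n} f = f zero + sumFin (λ i → f (suc i))

sumFinℕ : ∀ {n} → (Fin n → ℕ) → ℕ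
sumFinℕ {zero}  f = 0
sumFinℕ {suc n} f = f zero ℕ.+ sumFinℕ (λ i → f (suc i))

bool→ℕ : Bool → ℕ
bool→ℕ true  = 1
bool→ℕ false = 0

δ : ∀ {n} → Fin n → Fin n → ℤ
δ i j = if toℕ i ≡ᵇ toℕ j then + 1 else + 0

identity : ∀ {n} → Matrix n n
identity i j = δ i j

_·ᴹ_ : ∀ {m n p} → Matrix m n → Matrix n p → Matrix m p
(A ·ᴹ B) i j = sumFin (λ l → A i l * B l j)

_-ᴹ_ : ∀ {m n} → Matrix m n → Matrix m n → Matrix m n
(A -ᴹ B) i j = A i j - B i j

_^ᴹ_ : ∀ {n} → Matrix n n → ℕ → Matrix n n
A ^ᴹ zero  = identity
A ^ᴹ suc e = A ·ᴹ (A ^ᴹ e)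

_·ᵛ_ : ∀ {m n} → Matrix m n → Vec n → Vec m
(A ·ᵛ v) i = sumFin (λ l → A i l * v l)

-- Graphs, given by a symmetric adjacency matrix (multiplicities in ℕ)

AdjMatrix : ℕ → Set
AdjMatrix m = Fin m → Fin m → ℕ

laplacian : ∀ {m} → AdjMatrix m → Matrix m m
laplacian A i j = (if toℕ i ≡ᵇ toℕ j then + sumFinℕ (A i) else + 0) - + A i j

-- a mod n, with the convention a mod 0 = a (only used for n > 0)
_mod_ : ℕ → ℕ → ℕ
a mod zero  = a
a mod suc n = a % suc n

-- Entry (i,j) = number of l with j ≡ i + s_l or j ≡ i - s_l (mod n)
-- (for s_l < n/2 these two cases are exclusive and the graph is simple).
circulant : (n : ℕ) {k : ℕ} → (Fin k → ℕ) → AdjMatrix n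
circulant n s i j = sumFinℕ (λ l →
    bool→ℕ (((toℕ i ℕ.+ s l) mod n) ≡ᵇ toℕ j)
  ℕ.+ bool→ℕ (((toℕ j ℕ.+ s l) mod n) ≡ᵇ toℕ i))

cone : ∀ {m} → AdjMatrix m → AdjMatrix (suc m)
cone A zero    zero    = 0
cone A zero    (suc j) = 1
cone A (suc i) zero    = 1
cone A (suc i) (suc j) = A i j

_+ᵛ_ : ∀ {m} → Vec m → Vec m → Vec m
(x +ᵛ y) i = x i + y i

-- x ≈ y in Z^m / im M  iff  x - y ∈ im M
ImRel : ∀ {m s} → Matrix m s → Vec m → Vec m → Set
ImRel M x y = ∃ λ v → ∀ i → x i - y i ≡ (M ·ᵛ v) i

IsTorsion : ∀ {m s} → Matrix m s → Vec m → Set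
IsTorsion M x = Σ ℕ λ d → (1 ℕ.≤ d) × ImRel M (λ i → + d * x i) (λ i → + 0)

Everything : ∀ {m} → Vec m → Set
Everything x = ⊤' where open import Data.Unit using () renaming (⊤ to ⊤')

-- A group isomorphism between the subgroup {x | P x}/im M of Z^m/im M
-- and the subgroup {y | Q y}/im N of Z^t/im N (P, Q closed under +).
record GroupIso {m s t u : ℕ}
    (M : Matrix m s) (P : Vec m → Set)
    (N : Matrix t u) (Q : Vec t → Set) : Set where
  field
    f        : (x : Vec m) → P x → Vec t
    f-in     : ∀ x (px : P x) → Q (f x px)
    f-cong   : ∀ x y (px : P x) (py : P y) → ImRel M x y → ImRel N (f x px) (f y py)
    f-hom    : ∀ x y (px : P x) (py : P y) (pxy : P (x +ᵛ y)) →
               ImRel N (f (x +ᵛ y) pxy) (f x px +ᵛ f y py)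
    f-inj    : ∀ x y (px : P x) (py : P y) → ImRel N (f x px) (f y py) → ImRel M x y
    f-surj   : ∀ y → Q y → Σ (Vec m) λ x → Σ (P x) λ px → ImRel N (f x px) y

-- Jacobian of a graph H: torsion subgroup of Z^m / im L(H)
-- Jac(H) ≅ coker N, as abelian groups:
JacIsoCoker : ∀ {m t} → AdjMatrix m → Matrix t t → Set
JacIsoCoker {m} {t} A N =
  GroupIso (laplacian A) (IsTorsion (laplacian A)) N (Everything {t})

-- Q(z) = c (z^p + a_1 z^{p+1} + … + a_{s-1} z^{p+s-1} + z^{p+s}), c = ±1,
-- given by its coefficient function coeff : ℤ → ℤ; then a_i = c * coeff(p+i)
-- (since c⁻¹ = c).
companion : (s : ℕ) → (a : ℕ → ℤ) → Matrix s s
companion s a i j =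
  if (suc (toℕ i)) <ᵇ s
  then (if suc (toℕ i) ≡ᵇ toℕ j then + 1 else + 0)
  else (if toℕ j ≡ᵇ 0 then - + 1 else - a (toℕ j))

laurentCompanion : (c : ℤ) (p : ℤ) (s : ℕ) (coeff : ℤ → ℤ) → Matrix s s
laurentCompanion c p s coeff = companion s (λ i → c * coeff (p + + i))

circPolyCoeff : {k : ℕ} → (Fin k → ℕ) → ℤ → ℤ
circPolyCoeff {k} s j =
  (if ⌊ j ℤ.≟ + 0 ⌋ then + (2 ℕ.* k ℕ.+ 1) else + 0)
  - + sumFinℕ (λ l → bool→ℕ ⌊ j ℤ.≟ + s l ⌋ ℕ.+ bool→ℕ ⌊ j ℤ.≟ - + s l ⌋)

circCompanion : {k : ℕ} → (s : Fin (suc k) → ℕ) → (sk : ℕ) → Matrix (2 ℕ.* sk) (2 ℕ.* sk)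
circCompanion s sk = laurentCompanion (- + 1) (- + sk) (2 ℕ.* sk) (circPolyCoeff s)

-- For a potential v on the cone, let u(a) be its value at the vertex a mod n minus its
-- value at the apex. Row a + s_k of the Laplacian is then −Σⱼ qⱼ u(a + j), where
-- q₀, …, q_{2s_k} are the coefficients of z^{s_k}(2k+1 − Σ_l (z^{s_l} + z^{−s_l})); as
-- q₀ = q_{2s_k} = −1, this is the linear recurrence with companion matrix 𝒜. Running the
-- recurrence for n steps from the zero state, with the entries of x as forcing terms,
-- gives a homomorphism φ : ℤ^{n+1} → ℤ^{2s_k}. The image of L consists of the forcings
-- of n-periodic solutions, which φ sends into im(𝒜ⁿ − I); conversely a state fixed by the
-- forced recurrence yields a periodic solution and hence a preimage under L, and every
-- state is reached by some forcing. So φ identifies the vectors of coordinate sum zero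
-- modulo im L with coker(𝒜ⁿ − I), and these are exactly the torsion elements.

module Submission where

module CirculantConeJacobian where

  open import Defs
  open import Data.Bool using (true; false; if_then_else_; T)
  open import Data.Empty using (⊥-elim)
  open import Data.Fin as F using (Fin; zero; suc; toℕ; fromℕ; fromℕ<; inject₁; funToFin; finToFun)
  import Data.Fin.Properties as Finₚ
  open import Data.Integer as ℤ using (ℤ; +_; -_; -[1+_]; _+_; _-_; _*_; +≤+)
  import Data.Integer.Properties as ℤₚ
  open import Data.Integer.Solver using (module +-*-Solver)
  open import Data.Nat as ℕ using (ℕ; zero; suc; _≤_; _<_; z≤n; s≤s; _∸_; _%_; _≡ᵇ_; _<ᵇ_; _^_)
  import Data.Nat.DivMod as ℕ
  import Data.Nat.Properties as ℕₚ
  open import Data.Nat.Tactic.RingSolver using (solve-∀)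
  open import Data.Product using (Σ; ∃₂; _×_; _,_; proj₁; proj₂)
  open import Data.Unit using (tt)
  open import Relation.Binary.PropositionalEquality
  open import Relation.Nullary using (¬_; yes; no)
  open import Relation.Nullary.Decidable using (⌊_⌋)
  open +-*-Solver

  sumFin-cong : ∀ {n} {f g : Fin n → ℤ} → (∀ i → f i ≡ g i) → sumFin f ≡ sumFin g
  sumFin-cong {zero}  f≗g = refl
  sumFin-cong {suc n} f≗g = cong₂ _+_ (f≗g zero) (sumFin-cong (λ i → f≗g (suc i)))

  sumFin-zero : ∀ {n} (f : Fin n → ℤ) → (∀ i → f i ≡ + 0) → sumFin f ≡ + 0
  sumFin-zero {zero}  f f≗0 = refl
  sumFin-zero {suc n} f f≗0 =
    cong₂ _+_ (f≗0 zero) (sumFin-zero (λ i → f (suc i)) (λ i → f≗0 (suc i)))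

  sumFin-+ : ∀ {n} (f g : Fin n → ℤ) → sumFin (λ i → f i + g i) ≡ sumFin f + sumFin g
  sumFin-+ {zero}  f g = refl
  sumFin-+ {suc n} f g =
    trans (cong (_+_ (f zero + g zero)) (sumFin-+ (λ i → f (suc i)) (λ i → g (suc i))))
          (solve 4 (λ a b c d → a :+ b :+ (c :+ d) := a :+ c :+ (b :+ d)) refl (f zero) (g zero) _ _)

  sumFin-*ˡ : ∀ {n} (c : ℤ) (f : Fin n → ℤ) → sumFin (λ i → c * f i) ≡ c * sumFin f
  sumFin-*ˡ {zero}  c f = sym (ℤₚ.*-zeroʳ c)
  sumFin-*ˡ {suc n} c f =
    trans (cong (_+_ (c * f zero)) (sumFin-*ˡ c (λ i → f (suc i)))) (sym (ℤₚ.*-distribˡ-+ c (f zero) _))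

  sumFin-*ʳ : ∀ {n} (c : ℤ) (f : Fin n → ℤ) → sumFin (λ i → f i * c) ≡ sumFin f * c
  sumFin-*ʳ c f = trans (sumFin-cong (λ i → ℤₚ.*-comm (f i) c)) (trans (sumFin-*ˡ c f) (ℤₚ.*-comm c _))

  sumFin-neg : ∀ {n} (f : Fin n → ℤ) → sumFin (λ i → - f i) ≡ - sumFin f
  sumFin-neg f =
    trans (sumFin-cong (λ i → sym (ℤₚ.-1*i≡-i (f i)))) (trans (sumFin-*ˡ (- + 1) f) (ℤₚ.-1*i≡-i _))

  sumFin-- : ∀ {n} (f g : Fin n → ℤ) → sumFin (λ i → f i - g i) ≡ sumFin f - sumFin g
  sumFin-- f g = trans (sumFin-+ f (λ i → - g i)) (cong (_+_ (sumFin f)) (sumFin-neg g))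

  sumFin-const : ∀ n (c : ℤ) → sumFin {n} (λ _ → c) ≡ + n * c
  sumFin-const zero    c = refl
  sumFin-const (suc n) c =
    trans (cong (_+_ c) (sumFin-const n c)) (solve 2 (λ c n → c :+ n :* c := (con (+ 1) :+ n) :* c) refl c (+ n))

  sumFin-swap : ∀ {m n} (f : Fin m → Fin n → ℤ) →
    sumFin (λ i → sumFin (λ j → f i j)) ≡ sumFin (λ j → sumFin (λ i → f i j))
  sumFin-swap {zero}  {n} f = sym (sumFin-zero {n} (λ _ → + 0) (λ _ → refl))
  sumFin-swap {suc m} {n} f =
    trans (cong (_+_ (sumFin (f zero))) (sumFin-swap (λ i → f (suc i))))
          (sym (sumFin-+ (f zero) (λ j → sumFin (λ i → f (suc i) j))))

  sumFin-init-last : ∀ {m} (f : Fin (suc m) → ℤ) → sumFin f ≡ sumFin (λ j → f (inject₁ j)) + f (fromℕ m)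
  sumFin-init-last {zero}  f = ℤₚ.+-comm (f zero) (+ 0)
  sumFin-init-last {suc m} f =
    trans (cong (_+_ (f zero)) (sumFin-init-last (λ j → f (suc j)))) (sym (ℤₚ.+-assoc (f zero) _ _))

  sumFin-nonneg : ∀ {n} (f : Fin n → ℤ) → (∀ i → + 0 ℤ.≤ f i) → + 0 ℤ.≤ sumFin f
  sumFin-nonneg {zero}  f f≥0 = +≤+ z≤n
  sumFin-nonneg {suc n} f f≥0 = ℤₚ.+-mono-≤ (f≥0 zero) (sumFin-nonneg (λ i → f (suc i)) (λ i → f≥0 (suc i)))

  sumFin-indicator : ∀ {n} (e g : Fin n → ℤ) (j₀ : Fin n) →
    e j₀ ≡ + 1 → (∀ j → j ≢ j₀ → e j ≡ + 0) → sumFin (λ j → e j * g j) ≡ g j₀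
  sumFin-indicator {suc n} e g zero e₁ e₀ =
    trans (cong₂ _+_ (trans (cong (_* g zero) e₁) (ℤₚ.*-identityˡ (g zero)))
                     (sumFin-zero _ (λ i → cong (_* g (suc i)) (e₀ (suc i) (λ ())))))
          (ℤₚ.+-identityʳ (g zero))
  sumFin-indicator {suc n} e g (suc j₀) e₁ e₀ =
    trans (cong₂ _+_ (cong (_* g zero) (e₀ zero (λ ())))
                     (sumFin-indicator (λ j → e (suc j)) (λ j → g (suc j)) j₀ e₁
                       (λ j j≢j₀ → e₀ (suc j) (λ eq → j≢j₀ (Finₚ.suc-injective eq)))))
          (ℤₚ.+-identityˡ _)

  sumFin-indicatorℕ : ∀ {n} (e g : ℕ → ℤ) (a : ℕ) → a < n →
    e a ≡ + 1 → (∀ j → j ≢ a → e j ≡ + 0) → sumFin {n} (λ j → e (toℕ j) * g (toℕ j)) ≡ g a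
  sumFin-indicatorℕ e g a a<n e₁ e₀ =
    trans (sumFin-indicator (λ j → e (toℕ j)) (λ j → g (toℕ j)) (fromℕ< a<n)
             (trans (cong e (Finₚ.toℕ-fromℕ< a<n)) e₁)
             (λ j j≢a → e₀ (toℕ j) (λ eq → j≢a (Finₚ.toℕ-injective (trans eq (sym (Finₚ.toℕ-fromℕ< a<n)))))))
          (cong g (Finₚ.toℕ-fromℕ< a<n))

  sumFinℕ-cong : ∀ {n} {f g : Fin n → ℕ} → (∀ i → f i ≡ g i) → sumFinℕ f ≡ sumFinℕ g
  sumFinℕ-cong {zero}  f≗g = refl
  sumFinℕ-cong {suc n} f≗g = cong₂ ℕ._+_ (f≗g zero) (sumFinℕ-cong (λ i → f≗g (suc i)))

  sumFinℕ-toℤ : ∀ {n} (f : Fin n → ℕ) → + sumFinℕ f ≡ sumFin (λ i → + f i)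
  sumFinℕ-toℤ {zero}  f = refl
  sumFinℕ-toℤ {suc n} f = trans (ℤₚ.pos-+ (f zero) _) (cong (_+_ (+ f zero)) (sumFinℕ-toℤ (λ i → f (suc i))))

  term≤sumFinℕ : ∀ {n} (f : Fin n → ℕ) i → f i ≤ sumFinℕ f
  term≤sumFinℕ f zero    = ℕₚ.m≤m+n (f zero) _
  term≤sumFinℕ f (suc i) = ℕₚ.≤-trans (term≤sumFinℕ (λ j → f (suc j)) i) (ℕₚ.m≤n+m _ (f zero))

  ≡ᵇ-≡ : ∀ {m n} → m ≡ n → (m ≡ᵇ n) ≡ true
  ≡ᵇ-≡ {zero}  refl = refl
  ≡ᵇ-≡ {suc m} refl = ≡ᵇ-≡ {m} refl

  ≡ᵇ-≢ : ∀ {m n} → m ≢ n → (m ≡ᵇ n) ≡ false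
  ≡ᵇ-≢ {m} {n} m≢n with m ≡ᵇ n in eq
  ... | true  = ⊥-elim (m≢n (ℕₚ.≡ᵇ⇒≡ m n (subst T (sym eq) _)))
  ... | false = refl

  <ᵇ-< : ∀ {m n} → m < n → (m <ᵇ n) ≡ true
  <ᵇ-< {m} {n} m<n with m <ᵇ n in eq
  ... | true  = refl
  ... | false = ⊥-elim (subst T eq (ℕₚ.<⇒<ᵇ m<n))

  <ᵇ-≮ : ∀ {m n} → ¬ m < n → (m <ᵇ n) ≡ false
  <ᵇ-≮ {m} {n} m≮n with m <ᵇ n in eq
  ... | true  = ⊥-elim (m≮n (ℕₚ.<ᵇ⇒< m n (subst T (sym eq) _)))
  ... | false = refl

  δ-diag : ∀ {n} (i : Fin n) → δ i i ≡ + 1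
  δ-diag i rewrite ≡ᵇ-≡ {toℕ i} refl = refl

  δ-offdiag : ∀ {n} (i j : Fin n) → j ≢ i → δ i j ≡ + 0
  δ-offdiag i j j≢i rewrite ≡ᵇ-≢ (λ eq → j≢i (sym (Finₚ.toℕ-injective eq))) = refl

  basis : ∀ {n} → Fin n → Vec n
  basis b = δ b

  ·ᵛ-cong : ∀ {m n} (A : Matrix m n) {v w : Vec n} → (∀ j → v j ≡ w j) → ∀ i → (A ·ᵛ v) i ≡ (A ·ᵛ w) i
  ·ᵛ-cong A v≗w i = sumFin-cong (λ l → cong (A i l *_) (v≗w l))

  identity-·ᵛ : ∀ {n} (w : Vec n) i → (identity ·ᵛ w) i ≡ w i
  identity-·ᵛ w i = sumFin-indicator (δ i) w i (δ-diag i) (δ-offdiag i)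

  ·ᵛ-basis : ∀ {m n} (M : Matrix m n) b i → (M ·ᵛ basis b) i ≡ M i b
  ·ᵛ-basis M b i = trans (sumFin-cong (λ j → ℤₚ.*-comm (M i j) (δ b j)))
                         (sumFin-indicator (δ b) (M i) b (δ-diag b) (δ-offdiag b))

  ·ᴹ-·ᵛ-assoc : ∀ {m n p} (A : Matrix m n) (B : Matrix n p) (w : Vec p) i →
    ((A ·ᴹ B) ·ᵛ w) i ≡ (A ·ᵛ (B ·ᵛ w)) i
  ·ᴹ-·ᵛ-assoc A B w i = begin
    sumFin (λ l → sumFin (λ j → A i j * B j l) * w l)
      ≡⟨ sumFin-cong (λ l → sym (sumFin-*ʳ (w l) (λ j → A i j * B j l))) ⟩
    sumFin (λ l → sumFin (λ j → A i j * B j l * w l))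
      ≡⟨ sumFin-swap (λ l j → A i j * B j l * w l) ⟩
    sumFin (λ j → sumFin (λ l → A i j * B j l * w l))
      ≡⟨ sumFin-cong (λ j → trans (sumFin-cong (λ l → ℤₚ.*-assoc (A i j) (B j l) (w l)))
                                  (sumFin-*ˡ (A i j) (λ l → B j l * w l))) ⟩
    sumFin (λ j → A i j * sumFin (λ l → B j l * w l)) ∎
    where open ≡-Reasoning

  -ᴹ-·ᵛ : ∀ {m n} (A B : Matrix m n) (w : Vec n) i → ((A -ᴹ B) ·ᵛ w) i ≡ (A ·ᵛ w) i - (B ·ᵛ w) i
  -ᴹ-·ᵛ A B w i =
    trans (sumFin-cong (λ l → solve 3 (λ a b w → (a :- b) :* w := a :* w :- b :* w) refl (A i l) (B i l) (w l)))
          (sumFin-- (λ l → A i l * w l) (λ l → B i l * w l))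

  ·ᵛ-+ : ∀ {m n} (A : Matrix m n) (v w : Vec n) i → (A ·ᵛ (λ j → v j + w j)) i ≡ (A ·ᵛ v) i + (A ·ᵛ w) i
  ·ᵛ-+ A v w i = trans (sumFin-cong (λ l → ℤₚ.*-distribˡ-+ (A i l) (v l) (w l)))
                       (sumFin-+ (λ l → A i l * v l) (λ l → A i l * w l))

  ·ᵛ-* : ∀ {m n} (A : Matrix m n) (c : ℤ) (v : Vec n) i → (A ·ᵛ (λ j → c * v j)) i ≡ c * (A ·ᵛ v) i
  ·ᵛ-* A c v i =
    trans (sumFin-cong (λ l → solve 3 (λ a c v → a :* (c :* v) := c :* (a :* v)) refl (A i l) c (v l)))
          (sumFin-*ˡ c (λ l → A i l * v l))

  ·ᵛ-neg : ∀ {m n} (A : Matrix m n) (v : Vec n) i → (A ·ᵛ (λ j → - v j)) i ≡ - (A ·ᵛ v) i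
  ·ᵛ-neg A v i = trans (sumFin-cong (λ l → sym (ℤₚ.neg-distribʳ-* (A i l) (v l)))) (sumFin-neg (λ l → A i l * v l))

  ·ᵛ-zero : ∀ {m n} (A : Matrix m n) i → (A ·ᵛ (λ _ → + 0)) i ≡ + 0
  ·ᵛ-zero A i = sumFin-zero _ (λ l → ℤₚ.*-zeroʳ (A i l))

  module _ {m s} (M : Matrix m s) where

    ImRel-reflexive : ∀ {x y} → (∀ i → x i ≡ y i) → ImRel M x y
    ImRel-reflexive {x} {y} x≗y = (λ _ → + 0) , λ i →
      trans (cong (_-_ (x i)) (sym (x≗y i))) (trans (ℤₚ.+-inverseʳ (x i)) (sym (·ᵛ-zero M i)))

    ImRel-refl : ∀ x → ImRel M x x
    ImRel-refl x = ImRel-reflexive {x} {x} (λ _ → refl)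

    ImRel-sym : ∀ {x y} → ImRel M x y → ImRel M y x
    ImRel-sym {x} {y} (v , e) = (λ j → - v j) , λ i → begin
      y i - x i     ≡⟨ solve 2 (λ x y → y :- x := :- (x :- y)) refl (x i) (y i) ⟩
      - (x i - y i) ≡⟨ cong -_ (e i) ⟩
      - (M ·ᵛ v) i  ≡⟨ sym (·ᵛ-neg M v i) ⟩
      (M ·ᵛ (λ j → - v j)) i ∎
      where open ≡-Reasoning

    ImRel-trans : ∀ {x y z} → ImRel M x y → ImRel M y z → ImRel M x z
    ImRel-trans {x} {y} {z} (v , e) (w , f) = (λ j → v j + w j) , λ i → begin
      x i - z i                 ≡⟨ solve 3 (λ x y z → x :- z := (x :- y) :+ (y :- z)) refl (x i) (y i) (z i) ⟩
      (x i - y i) + (y i - z i) ≡⟨ cong₂ _+_ (e i) (f i) ⟩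
      (M ·ᵛ v) i + (M ·ᵛ w) i   ≡⟨ sym (·ᵛ-+ M v w i) ⟩
      (M ·ᵛ (λ j → v j + w j)) i ∎
      where open ≡-Reasoning

    ImRel-difference : ∀ {x y} → ImRel M (λ i → x i - y i) (λ _ → + 0) → ImRel M x y
    ImRel-difference {x} {y} (v , e) = v , λ i → trans (sym (ℤₚ.+-identityʳ (x i - y i))) (e i)

    ImRel-multiples⇒IsTorsion : ∀ x {a b} → a < b → ImRel M (λ i → + b * x i) (λ i → + a * x i) → IsTorsion M x
    ImRel-multiples⇒IsTorsion x {a} {b} a<b (v , bx-ax≡Mv) =
      b ∸ a , ℕₚ.m<n⇒0<n∸m a<b , v ,
      λ i → trans (ℤₚ.+-identityʳ (+ (b ∸ a) * x i)) (trans (sym (difference i)) (bx-ax≡Mv i))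
      where
      difference : ∀ i → + b * x i - + a * x i ≡ + (b ∸ a) * x i
      difference i = trans (solve 3 (λ b a x → b :* x :- a :* x := (b :- a) :* x) refl (+ b) (+ a) (x i))
                           (cong (_* x i) (trans (ℤₚ.m-n≡m⊖n b a) (ℤₚ.⊖-≥ (ℕₚ.<⇒≤ a<b))))

  module Companion (m : ℕ) (a : ℕ → ℤ) where

    𝒜 : Matrix (suc m) (suc m)
    𝒜 = companion (suc m) a

    companion-shift : ∀ (w : Vec (suc m)) i j → toℕ j ≡ suc (toℕ i) → (𝒜 ·ᵛ w) i ≡ w j
    companion-shift w i j j≡1+i = sumFin-indicator (𝒜 i) w j e₁ e₀
      where
      i<m : toℕ i < m
      i<m = ℕₚ.≤-pred (subst (_< suc m) j≡1+i (Finₚ.toℕ<n j))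
      e₁ : 𝒜 i j ≡ + 1
      e₁ rewrite <ᵇ-< i<m | j≡1+i | ≡ᵇ-≡ {toℕ i} refl = refl
      e₀ : ∀ l → l ≢ j → 𝒜 i l ≡ + 0
      e₀ l l≢j rewrite <ᵇ-< i<m
        | ≡ᵇ-≢ (λ eq → l≢j (Finₚ.toℕ-injective (trans (sym eq) (sym j≡1+i)))) = refl

    weightedSum : Vec (suc m) → ℤ
    weightedSum w = w zero + sumFin (λ j → a (suc (toℕ j)) * w (suc j))

    weightedSum-cong : ∀ {v w : Vec (suc m)} → (∀ j → v j ≡ w j) → weightedSum v ≡ weightedSum w
    weightedSum-cong v≗w = cong₂ _+_ (v≗w zero) (sumFin-cong (λ j → cong (a (suc (toℕ j)) *_) (v≗w (suc j))))

    companion-last : ∀ (w : Vec (suc m)) i → toℕ i ≡ m → (𝒜 ·ᵛ w) i ≡ - weightedSum w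
    companion-last w i i≡m = begin
      (𝒜 ·ᵛ w) i
        ≡⟨ cong₂ _+_ first (sumFin-cong rest) ⟩
      - w zero + sumFin (λ j → - (a (suc (toℕ j)) * w (suc j)))
        ≡⟨ cong (_+_ (- w zero)) (sumFin-neg (λ j → a (suc (toℕ j)) * w (suc j))) ⟩
      - w zero + - sumFin (λ j → a (suc (toℕ j)) * w (suc j))
        ≡⟨ sym (ℤₚ.neg-distrib-+ (w zero) _) ⟩
      - weightedSum w ∎
      where
      open ≡-Reasoning
      last : ¬ suc (toℕ i) < suc m
      last 1+i<1+m = ℕₚ.<-irrefl i≡m (ℕₚ.≤-pred 1+i<1+m)
      first : 𝒜 i zero * w zero ≡ - w zero
      first rewrite <ᵇ-≮ last = ℤₚ.-1*i≡-i (w zero)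
      rest : ∀ j → 𝒜 i (suc j) * w (suc j) ≡ - (a (suc (toℕ j)) * w (suc j))
      rest j rewrite <ᵇ-≮ last = sym (ℤₚ.neg-distribˡ-* (a (suc (toℕ j))) (w (suc j)))

    eLast : Vec (suc m)
    eLast i = if toℕ i ≡ᵇ m then + 1 else + 0

    eLast-last : ∀ i → toℕ i ≡ m → eLast i ≡ + 1
    eLast-last i i≡m rewrite ≡ᵇ-≡ i≡m = refl

    eLast-other : ∀ i → toℕ i ≢ m → eLast i ≡ + 0
    eLast-other i i≢m rewrite ≡ᵇ-≢ i≢m = refl

    window : (ℕ → ℤ) → ℕ → Vec (suc m)
    window u t j = u (t ℕ.+ toℕ j)

    -- residual u ≗ 0 is the recurrence with characteristic polynomial 1 + a₁ z + … + a_m z^m + z^(m+1).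
    residual : (ℕ → ℤ) → ℕ → ℤ
    residual u t = weightedSum (window u t) + u (t ℕ.+ suc m)

    residual-cong : ∀ {u u'} → (∀ t → u t ≡ u' t) → ∀ t → residual u t ≡ residual u' t
    residual-cong u≗u' t = cong₂ _+_ (weightedSum-cong (λ j → u≗u' (t ℕ.+ toℕ j))) (u≗u' (t ℕ.+ suc m))

    nextIndex : ∀ (i : Fin (suc m)) → toℕ i ≢ m → Σ (Fin (suc m)) λ j → toℕ j ≡ suc (toℕ i)
    nextIndex i i≢m = fromℕ< (s≤s i<m) , Finₚ.toℕ-fromℕ< (s≤s i<m)
      where i<m = ℕₚ.≤∧≢⇒< (ℕₚ.≤-pred (Finₚ.toℕ<n i)) i≢m

    window-suc : ∀ u t i → window u (suc t) i ≡ (𝒜 ·ᵛ window u t) i + eLast i * residual u t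
    window-suc u t i with toℕ i ℕₚ.≟ m
    ... | yes i≡m = begin
        u (suc t ℕ.+ toℕ i)  ≡⟨ cong u (trans (cong (suc t ℕ.+_) i≡m) (sym (ℕₚ.+-suc t m))) ⟩
        u (t ℕ.+ suc m)      ≡⟨ solve 2 (λ S x → x := :- S :+ (S :+ x)) refl (weightedSum (window u t)) (u (t ℕ.+ suc m)) ⟩
        - weightedSum (window u t) + residual u t
          ≡⟨ cong₂ _+_ (sym (companion-last (window u t) i i≡m))
                       (sym (trans (cong (_* residual u t) (eLast-last i i≡m)) (ℤₚ.*-identityˡ _))) ⟩
        (𝒜 ·ᵛ window u t) i + eLast i * residual u t ∎
      where open ≡-Reasoning
    ... | no i≢m = begin
        u (suc t ℕ.+ toℕ i)
          ≡⟨ cong u (trans (sym (ℕₚ.+-suc t (toℕ i))) (cong (t ℕ.+_) (sym (proj₂ (nextIndex i i≢m))))) ⟩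
        window u t (proj₁ (nextIndex i i≢m)) ≡⟨ sym (companion-shift (window u t) i _ (proj₂ (nextIndex i i≢m))) ⟩
        (𝒜 ·ᵛ window u t) i          ≡⟨ sym (ℤₚ.+-identityʳ _) ⟩
        (𝒜 ·ᵛ window u t) i + + 0    ≡⟨ cong (_+_ ((𝒜 ·ᵛ window u t) i))
                                           (sym (trans (cong (_* residual u t) (eLast-other i i≢m)) (ℤₚ.*-zeroˡ (residual u t)))) ⟩
        (𝒜 ·ᵛ window u t) i + eLast i * residual u t ∎
      where open ≡-Reasoning

    orbit : Vec (suc m) → (ℕ → ℤ) → ℕ → Vec (suc m)
    orbit w₀ Y zero    = w₀
    orbit w₀ Y (suc t) i = (𝒜 ·ᵛ orbit w₀ Y t) i - eLast i * Y t

    orbit-cong : ∀ {w w' Y Y'} → (∀ i → w i ≡ w' i) → (∀ t → Y t ≡ Y' t) → ∀ t i → orbit w Y t i ≡ orbit w' Y' t i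
    orbit-cong w≗w' Y≗Y' zero    i = w≗w' i
    orbit-cong w≗w' Y≗Y' (suc t) i =
      cong₂ _-_ (·ᵛ-cong 𝒜 (orbit-cong w≗w' Y≗Y' t) i) (cong (eLast i *_) (Y≗Y' t))

    orbit-+ : ∀ w w' Y Y' t i →
      orbit (λ j → w j + w' j) (λ t → Y t + Y' t) t i ≡ orbit w Y t i + orbit w' Y' t i
    orbit-+ w w' Y Y' zero    i = refl
    orbit-+ w w' Y Y' (suc t) i = begin
      (𝒜 ·ᵛ orbit (λ j → w j + w' j) (λ t → Y t + Y' t) t) i - eLast i * (Y t + Y' t)
        ≡⟨ cong (_- eLast i * (Y t + Y' t))
             (trans (·ᵛ-cong 𝒜 (orbit-+ w w' Y Y' t) i) (·ᵛ-+ 𝒜 (orbit w Y t) (orbit w' Y' t) i)) ⟩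
      ((𝒜 ·ᵛ orbit w Y t) i + (𝒜 ·ᵛ orbit w' Y' t) i) - eLast i * (Y t + Y' t)
        ≡⟨ solve 5 (λ p q e y y' → (p :+ q) :- e :* (y :+ y') := (p :- e :* y) :+ (q :- e :* y')) refl
             ((𝒜 ·ᵛ orbit w Y t) i) ((𝒜 ·ᵛ orbit w' Y' t) i) (eLast i) (Y t) (Y' t) ⟩
      orbit w Y (suc t) i + orbit w' Y' (suc t) i ∎
      where open ≡-Reasoning

    orbit-- : ∀ w w' Y Y' t i →
      orbit (λ j → w j - w' j) (λ t → Y t - Y' t) t i ≡ orbit w Y t i - orbit w' Y' t i
    orbit-- w w' Y Y' zero    i = refl
    orbit-- w w' Y Y' (suc t) i = begin
      (𝒜 ·ᵛ orbit (λ j → w j - w' j) (λ t → Y t - Y' t) t) i - eLast i * (Y t - Y' t)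
        ≡⟨ cong (_- eLast i * (Y t - Y' t)) (trans (·ᵛ-cong 𝒜 (orbit-- w w' Y Y' t) i)
             (trans (·ᵛ-+ 𝒜 (orbit w Y t) (λ j → - orbit w' Y' t j) i)
                    (cong (_+_ ((𝒜 ·ᵛ orbit w Y t) i)) (·ᵛ-neg 𝒜 (orbit w' Y' t) i)))) ⟩
      ((𝒜 ·ᵛ orbit w Y t) i - (𝒜 ·ᵛ orbit w' Y' t) i) - eLast i * (Y t - Y' t)
        ≡⟨ solve 5 (λ p q e y y' → (p :- q) :- e :* (y :- y') := (p :- e :* y) :- (q :- e :* y')) refl
             ((𝒜 ·ᵛ orbit w Y t) i) ((𝒜 ·ᵛ orbit w' Y' t) i) (eLast i) (Y t) (Y' t) ⟩
      orbit w Y (suc t) i - orbit w' Y' (suc t) i ∎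
      where open ≡-Reasoning

    orbit-unforced : ∀ w t i → orbit w (λ _ → + 0) t i ≡ ((𝒜 ^ᴹ t) ·ᵛ w) i
    orbit-unforced w zero    i = sym (identity-·ᵛ w i)
    orbit-unforced w (suc t) i = begin
      (𝒜 ·ᵛ orbit w (λ _ → + 0) t) i - eLast i * + 0
        ≡⟨ cong₂ _-_ (·ᵛ-cong 𝒜 (orbit-unforced w t) i) (ℤₚ.*-zeroʳ (eLast i)) ⟩
      (𝒜 ·ᵛ ((𝒜 ^ᴹ t) ·ᵛ w)) i - + 0 ≡⟨ ℤₚ.+-identityʳ _ ⟩
      (𝒜 ·ᵛ ((𝒜 ^ᴹ t) ·ᵛ w)) i       ≡⟨ sym (·ᴹ-·ᵛ-assoc 𝒜 (𝒜 ^ᴹ t) w i) ⟩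
      ((𝒜 ^ᴹ suc t) ·ᵛ w) i ∎
      where open ≡-Reasoning

    orbit-periodic : ∀ w Y n → (∀ t → Y (t ℕ.+ n) ≡ Y t) → (∀ i → orbit w Y n i ≡ w i) →
      ∀ t i → orbit w Y (t ℕ.+ n) i ≡ orbit w Y t i
    orbit-periodic w Y n Y-per fixed zero    i = fixed i
    orbit-periodic w Y n Y-per fixed (suc t) i =
      cong₂ _-_ (·ᵛ-cong 𝒜 (orbit-periodic w Y n Y-per fixed t) i) (cong (eLast i *_) (Y-per t))

    solution-orbit-difference : ∀ u Y w₀ T → (∀ t → t < T → residual u t + Y t ≡ + 0) →
      ∀ i → window u T i - orbit w₀ Y T i ≡ ((𝒜 ^ᴹ T) ·ᵛ (λ j → window u 0 j - w₀ j)) i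
    solution-orbit-difference u Y w₀ zero    solves i = sym (identity-·ᵛ (λ j → window u 0 j - w₀ j) i)
    solution-orbit-difference u Y w₀ (suc T) solves i = begin
      window u (suc T) i - orbit w₀ Y (suc T) i
        ≡⟨ cong (_- orbit w₀ Y (suc T) i) (window-suc u T i) ⟩
      ((𝒜 ·ᵛ window u T) i + eLast i * residual u T) - ((𝒜 ·ᵛ orbit w₀ Y T) i - eLast i * Y T)
        ≡⟨ solve 5 (λ p q e r y → (p :+ e :* r) :- (q :- e :* y) := (p :- q) :+ e :* (r :+ y)) refl
             ((𝒜 ·ᵛ window u T) i) ((𝒜 ·ᵛ orbit w₀ Y T) i) (eLast i) (residual u T) (Y T) ⟩
      ((𝒜 ·ᵛ window u T) i - (𝒜 ·ᵛ orbit w₀ Y T) i) + eLast i * (residual u T + Y T)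
        ≡⟨ cong₂ _+_ (sym (trans (·ᵛ-+ 𝒜 (window u T) (λ j → - orbit w₀ Y T j) i)
                                  (cong (_+_ ((𝒜 ·ᵛ window u T) i)) (·ᵛ-neg 𝒜 (orbit w₀ Y T) i))))
                     (trans (cong (eLast i *_) (solves T (ℕₚ.n<1+n T))) (ℤₚ.*-zeroʳ (eLast i))) ⟩
      (𝒜 ·ᵛ (λ j → window u T j - orbit w₀ Y T j)) i + + 0
        ≡⟨ ℤₚ.+-identityʳ _ ⟩
      (𝒜 ·ᵛ (λ j → window u T j - orbit w₀ Y T j)) i
        ≡⟨ ·ᵛ-cong 𝒜 (solution-orbit-difference u Y w₀ T (λ t t<T → solves t (ℕₚ.m<n⇒m<1+n t<T))) i ⟩
      (𝒜 ·ᵛ ((𝒜 ^ᴹ T) ·ᵛ (λ j → window u 0 j - w₀ j))) i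
        ≡⟨ sym (·ᴹ-·ᵛ-assoc 𝒜 (𝒜 ^ᴹ T) (λ j → window u 0 j - w₀ j) i) ⟩
      ((𝒜 ^ᴹ suc T) ·ᵛ (λ j → window u 0 j - w₀ j)) i ∎
      where open ≡-Reasoning

    orbit-shift : ∀ w Y t i j → toℕ j ≡ suc (toℕ i) → orbit w Y (suc t) i ≡ orbit w Y t j
    orbit-shift w Y t i j j≡1+i = begin
      (𝒜 ·ᵛ orbit w Y t) i - eLast i * Y t
        ≡⟨ cong₂ _-_ (companion-shift (orbit w Y t) i j j≡1+i)
                     (trans (cong (_* Y t) (eLast-other i i≢m)) (ℤₚ.*-zeroˡ (Y t))) ⟩
      orbit w Y t j - + 0 ≡⟨ ℤₚ.+-identityʳ _ ⟩
      orbit w Y t j ∎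
      where
      open ≡-Reasoning
      i≢m : toℕ i ≢ m
      i≢m i≡m = ℕₚ.<-irrefl refl (subst (_< suc m) (trans j≡1+i (cong suc i≡m)) (Finₚ.toℕ<n j))

    orbitSeq : Vec (suc m) → (ℕ → ℤ) → ℕ → ℤ
    orbitSeq w Y t = orbit w Y t zero

    orbit-orbitSeq : ∀ w Y k t (j : Fin (suc m)) → toℕ j ≡ k → orbit w Y t j ≡ orbitSeq w Y (t ℕ.+ k)
    orbit-orbitSeq w Y zero t j j≡0 =
      trans (cong (orbit w Y t) (Finₚ.toℕ-injective {i = j} {j = zero} j≡0)) (cong (orbitSeq w Y) (sym (ℕₚ.+-identityʳ t)))
    orbit-orbitSeq w Y (suc k) t j j≡1+k = begin
      orbit w Y t j            ≡⟨ sym (orbit-shift w Y t i j (trans j≡1+k (cong suc (sym i≡k)))) ⟩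
      orbit w Y (suc t) i      ≡⟨ orbit-orbitSeq w Y k (suc t) i i≡k ⟩
      orbitSeq w Y (suc t ℕ.+ k) ≡⟨ cong (orbitSeq w Y) (sym (ℕₚ.+-suc t k)) ⟩
      orbitSeq w Y (t ℕ.+ suc k) ∎
      where
      open ≡-Reasoning
      k<1+m : k < suc m
      k<1+m = ℕₚ.<-trans (ℕₚ.n<1+n k) (subst (_< suc m) j≡1+k (Finₚ.toℕ<n j))
      i : Fin (suc m)
      i = fromℕ< k<1+m
      i≡k : toℕ i ≡ k
      i≡k = Finₚ.toℕ-fromℕ< k<1+m

    orbit-window : ∀ w Y t j → orbit w Y t j ≡ window (orbitSeq w Y) t j
    orbit-window w Y t j = orbit-orbitSeq w Y (toℕ j) t j refl

    orbitSeq-solves : ∀ w Y t → residual (orbitSeq w Y) t + Y t ≡ + 0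
    orbitSeq-solves w Y t = begin
      weightedSum (window u t) + u (t ℕ.+ suc m) + Y t
        ≡⟨ cong (λ z → weightedSum (window u t) + z + Y t) (sym top) ⟩
      weightedSum (window u t) + orbit w Y (suc t) (fromℕ m) + Y t
        ≡⟨ cong (λ z → weightedSum (window u t) + z + Y t)
             (cong₂ _-_ (companion-last (orbit w Y t) (fromℕ m) (Finₚ.toℕ-fromℕ m))
                        (trans (cong (_* Y t) (eLast-last (fromℕ m) (Finₚ.toℕ-fromℕ m))) (ℤₚ.*-identityˡ (Y t)))) ⟩
      weightedSum (window u t) + (- weightedSum (orbit w Y t) - Y t) + Y t
        ≡⟨ cong (λ z → weightedSum (window u t) + (- z - Y t) + Y t) (weightedSum-cong (orbit-window w Y t)) ⟩
      weightedSum (window u t) + (- weightedSum (window u t) - Y t) + Y t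
        ≡⟨ solve 2 (λ S y → S :+ (:- S :- y) :+ y := con (+ 0)) refl (weightedSum (window u t)) (Y t) ⟩
      + 0 ∎
      where
      open ≡-Reasoning
      u : ℕ → ℤ
      u = orbitSeq w Y
      top : orbit w Y (suc t) (fromℕ m) ≡ u (t ℕ.+ suc m)
      top = trans (orbit-orbitSeq w Y m (suc t) (fromℕ m) (Finₚ.toℕ-fromℕ m)) (cong u (sym (ℕₚ.+-suc t m)))

  Symmetric : ∀ {m} → AdjMatrix m → Set
  Symmetric A = ∀ i j → A i j ≡ A j i

  degree : ∀ {m} → AdjMatrix m → Fin m → ℤ
  degree A i = + sumFinℕ (A i)

  laplacian-diag : ∀ {m} (A : AdjMatrix m) i → laplacian A i i ≡ degree A i - + A i i
  laplacian-diag A i rewrite ≡ᵇ-≡ {toℕ i} refl = refl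

  laplacian-offdiag : ∀ {m} (A : AdjMatrix m) i j → i ≢ j → laplacian A i j ≡ + 0 - + A i j
  laplacian-offdiag A i j i≢j rewrite ≡ᵇ-≢ (λ eq → i≢j (Finₚ.toℕ-injective eq)) = refl

  laplacian-·ᵛ : ∀ {m} (A : AdjMatrix m) (v : Vec m) i →
    (laplacian A ·ᵛ v) i ≡ degree A i * v i - sumFin (λ j → + A i j * v j)
  laplacian-·ᵛ A v i = begin
    sumFin (λ j → laplacian A i j * v j)
      ≡⟨ sumFin-cong (λ j → trans (cong (λ z → (z - + A i j) * v j) (diagonal j))
           (solve 4 (λ e d a w → (e :* d :- a) :* w := e :* (d :* w) :- a :* w) refl (δ i j) (degree A i) (+ A i j) (v j))) ⟩
    sumFin (λ j → δ i j * (degree A i * v j) - + A i j * v j)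
      ≡⟨ sumFin-- (λ j → δ i j * (degree A i * v j)) (λ j → + A i j * v j) ⟩
    sumFin (λ j → δ i j * (degree A i * v j)) - sumFin (λ j → + A i j * v j)
      ≡⟨ cong (_- sumFin (λ j → + A i j * v j))
           (sumFin-indicator (δ i) (λ j → degree A i * v j) i (δ-diag i) (δ-offdiag i)) ⟩
    degree A i * v i - sumFin (λ j → + A i j * v j) ∎
    where
    open ≡-Reasoning
    diagonal : ∀ j → (if toℕ i ≡ᵇ toℕ j then degree A i else + 0) ≡ δ i j * degree A i
    diagonal j with toℕ i ≡ᵇ toℕ j
    ... | true  = sym (ℤₚ.*-identityˡ (degree A i))
    ... | false = refl

  sum-laplacian-·ᵛ : ∀ {m} (A : AdjMatrix m) → Symmetric A → (v : Vec m) →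
    sumFin (laplacian A ·ᵛ v) ≡ + 0
  sum-laplacian-·ᵛ A A-sym v = begin
    sumFin (laplacian A ·ᵛ v)
      ≡⟨ sumFin-cong (laplacian-·ᵛ A v) ⟩
    sumFin (λ i → degree A i * v i - sumFin (λ j → + A i j * v j))
      ≡⟨ sumFin-- (λ i → degree A i * v i) (λ i → sumFin (λ j → + A i j * v j)) ⟩
    sumFin (λ i → degree A i * v i) - sumFin (λ i → sumFin (λ j → + A i j * v j))
      ≡⟨ cong (_-_ (sumFin (λ i → degree A i * v i))) (trans (sumFin-swap (λ i j → + A i j * v j)) (sumFin-cong column)) ⟩
    sumFin (λ i → degree A i * v i) - sumFin (λ j → degree A j * v j)
      ≡⟨ ℤₚ.+-inverseʳ (sumFin (λ i → degree A i * v i)) ⟩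
    + 0 ∎
    where
    open ≡-Reasoning
    column : ∀ j → sumFin (λ i → + A i j * v j) ≡ degree A j * v j
    column j = trans (sumFin-*ʳ (v j) (λ i → + A i j))
      (cong (_* v j) (trans (sumFin-cong (λ i → cong +_ (A-sym i j))) (sym (sumFinℕ-toℤ (A j)))))

  head≡-sumTail : ∀ {m} (z : Vec (suc m)) → sumFin z ≡ + 0 → z zero ≡ - sumFin (λ i → z (suc i))
  head≡-sumTail z Σz≡0 = begin
    z zero                                ≡⟨ solve 2 (λ a b → a := (a :+ b) :- b) refl (z zero) (sumFin (λ i → z (suc i))) ⟩
    sumFin z - sumFin (λ i → z (suc i))   ≡⟨ cong (_- sumFin (λ i → z (suc i))) Σz≡0 ⟩
    + 0 - sumFin (λ i → z (suc i))        ≡⟨ ℤₚ.+-identityˡ _ ⟩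
    - sumFin (λ i → z (suc i)) ∎
    where open ≡-Reasoning

  sum≡0-head : ∀ {m} (x y z : Vec (suc m)) → sumFin x ≡ + 0 → sumFin y ≡ + 0 → sumFin z ≡ + 0 →
    (∀ i → x (suc i) - y (suc i) ≡ z (suc i)) → x zero - y zero ≡ z zero
  sum≡0-head x y z Σx≡0 Σy≡0 Σz≡0 tail = begin
    x zero - y zero
      ≡⟨ cong₂ _-_ (head≡-sumTail x Σx≡0) (head≡-sumTail y Σy≡0) ⟩
    - sumFin (λ i → x (suc i)) - - sumFin (λ i → y (suc i))
      ≡⟨ solve 2 (λ a b → :- a :- :- b := :- (a :- b)) refl (sumFin (λ i → x (suc i))) (sumFin (λ i → y (suc i))) ⟩
    - (sumFin (λ i → x (suc i)) - sumFin (λ i → y (suc i)))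
      ≡⟨ cong -_ (trans (sym (sumFin-- (λ i → x (suc i)) (λ i → y (suc i)))) (sumFin-cong tail)) ⟩
    - sumFin (λ i → z (suc i))
      ≡⟨ sym (head≡-sumTail z Σz≡0) ⟩
    z zero ∎
    where open ≡-Reasoning

  IsTorsion⇒sum≡0 : ∀ {m} (A : AdjMatrix m) → Symmetric A → ∀ x → IsTorsion (laplacian A) x → sumFin x ≡ + 0
  IsTorsion⇒sum≡0 A A-sym x (suc d , _ , v , dx≡Lv) = ℤₚ.*-cancelˡ-≡ (+ suc d) (sumFin x) (+ 0) (begin
    + suc d * sumFin x          ≡⟨ sym (sumFin-*ˡ (+ suc d) x) ⟩
    sumFin (λ i → + suc d * x i) ≡⟨ sumFin-cong (λ i → trans (sym (ℤₚ.+-identityʳ (+ suc d * x i))) (dx≡Lv i)) ⟩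
    sumFin (laplacian A ·ᵛ v)   ≡⟨ sum-laplacian-·ᵛ A A-sym v ⟩
    + 0                         ≡⟨ sym (ℤₚ.*-zeroʳ (+ suc d)) ⟩
    + suc d * + 0 ∎)
    where open ≡-Reasoning

  ImRel-laplacian⇒sum≡ : ∀ {m} (A : AdjMatrix m) → Symmetric A → ∀ x y → ImRel (laplacian A) x y → sumFin x ≡ sumFin y
  ImRel-laplacian⇒sum≡ A A-sym x y (v , x-y≡Lv) =
    ℤₚ.i-j≡0⇒i≡j _ _ (trans (sym (sumFin-- x y)) (trans (sumFin-cong x-y≡Lv) (sum-laplacian-·ᵛ A A-sym v)))

  cone-symmetric : ∀ {m} (A : AdjMatrix m) → Symmetric A → Symmetric (cone A)
  cone-symmetric A A-sym zero    zero    = refl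
  cone-symmetric A A-sym zero    (suc j) = refl
  cone-symmetric A A-sym (suc i) zero    = refl
  cone-symmetric A A-sym (suc i) (suc j) = A-sym i j

  -- Chip-firing with the apex as sink brings every multiple of a sum-zero vector to
  -- one of finitely many stable configurations, so two distinct multiples are equivalent.
  module ConeTorsion {m} (A : AdjMatrix m) (A-sym : Symmetric A) where

    L : Matrix (suc m) (suc m)
    L = laplacian (cone A)

    NonNegative : Vec (suc m) → Set
    NonNegative x = ∀ a → + 0 ℤ.≤ x (suc a)

    Stable : Vec (suc m) → Set
    Stable r = ∀ a → (+ 0 ℤ.≤ r (suc a)) × (r (suc a) ℤ.< degree (cone A) (suc a))

    Stabilizable : Vec (suc m) → Set
    Stabilizable x = Σ (Vec (suc m)) λ r → ImRel L x r × Stable r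

    tailSum : Vec (suc m) → ℤ
    tailSum x = sumFin (λ a → x (suc a))

    fire : Vec (suc m) → Fin m → Vec (suc m)
    fire x b i = x i - L i (suc b)

    fire-ImRel : ∀ x b → ImRel L x (fire x b)
    fire-ImRel x b = basis (suc b) , λ i →
      trans (solve 2 (λ x l → x :- (x :- l) := l) refl (x i) (L i (suc b))) (sym (·ᵛ-basis L (suc b) i))

    fire-nonNegative : ∀ x b → NonNegative x → degree (cone A) (suc b) ℤ.≤ x (suc b) → NonNegative (fire x b)
    fire-nonNegative x b x≥0 deg≤x a with a Finₚ.≟ b
    ... | yes refl = subst (+ 0 ℤ.≤_) (sym fired) (ℤₚ.+-mono-≤ (ℤₚ.i≤j⇒0≤j-i deg≤x) (+≤+ z≤n))
      where
      fired : x (suc a) - L (suc a) (suc a) ≡ (x (suc a) - degree (cone A) (suc a)) + + A a a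
      fired = trans (cong (_-_ (x (suc a))) (laplacian-diag (cone A) (suc a)))
                    (solve 3 (λ x d c → x :- (d :- c) := (x :- d) :+ c) refl (x (suc a)) (degree (cone A) (suc a)) (+ A a a))
    ... | no a≢b = subst (+ 0 ℤ.≤_) (sym fired) (ℤₚ.+-mono-≤ (x≥0 a) (+≤+ z≤n))
      where
      fired : x (suc a) - L (suc a) (suc b) ≡ x (suc a) + + A a b
      fired = trans (cong (_-_ (x (suc a))) (laplacian-offdiag (cone A) (suc a) (suc b) (λ eq → a≢b (Finₚ.suc-injective eq))))
                    (solve 2 (λ x c → x :- (con (+ 0) :- c) := x :+ c) refl (x (suc a)) (+ A a b))

    -- Firing a vertex sends exactly one chip to the apex.
    tailSum-fire : ∀ x b → tailSum (fire x b) ≡ tailSum x - + 1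
    tailSum-fire x b = trans (sumFin-- (λ a → x (suc a)) (λ a → L (suc a) (suc b))) (cong (_-_ (tailSum x)) column)
      where
      column : sumFin (λ a → L (suc a) (suc b)) ≡ + 1
      column = begin
        sumFin (λ a → L (suc a) (suc b))
          ≡⟨ solve 2 (λ s z → s := (z :+ s) :- z) refl (sumFin (λ a → L (suc a) (suc b))) (L zero (suc b)) ⟩
        sumFin (λ i → L i (suc b)) - L zero (suc b)
          ≡⟨ cong (_- L zero (suc b)) (trans (sumFin-cong (λ i → sym (·ᵛ-basis L (suc b) i)))
                                             (sum-laplacian-·ᵛ (cone A) (cone-symmetric A A-sym) (basis (suc b)))) ⟩
        + 0 - (+ 0 - + 1) ≡⟨⟩
        + 1 ∎
        where open ≡-Reasoning

    stabilize-nonNegative : ∀ fuel x → NonNegative x → tailSum x ℤ.≤ + fuel → Stabilizable x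
    stabilize-nonNegative fuel x x≥0 Σ≤fuel with Finₚ.any? (λ b → degree (cone A) (suc b) ℤₚ.≤? x (suc b))
    ... | no unstable = x , ImRel-refl L x , λ a → x≥0 a , ℤₚ.≰⇒> (λ deg≤x → unstable (a , deg≤x))
    ... | yes (b , deg≤x) with fuel
    ...   | zero  =
      ⊥-elim (ℤₚ.<⇒≱ (ℤₚ.≤-<-trans (sumFin-nonneg _ (fire-nonNegative x b x≥0 deg≤x)) fired<0) ℤₚ.≤-refl)
      where
      fired<0 : tailSum (fire x b) ℤ.< + 0
      fired<0 = subst (ℤ._< + 0) (sym (tailSum-fire x b)) (ℤₚ.≤-<-trans (ℤₚ.+-monoˡ-≤ (- + 1) Σ≤fuel) (ℤ.-<+ {0} {0}))
    ...   | suc f =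
      let r , fired~r , r-stable = stabilize-nonNegative f (fire x b) (fire-nonNegative x b x≥0 deg≤x) fired≤f
      in  r , ImRel-trans L {x} {fire x b} {r} (fire-ImRel x b) fired~r , r-stable
      where
      fired≤f : tailSum (fire x b) ℤ.≤ + f
      fired≤f = subst (ℤ._≤ + f) (sym (tailSum-fire x b))
        (subst (tailSum x - + 1 ℤ.≤_) (solve 1 (λ f → con (+ 1) :+ f :- con (+ 1) := f) refl (+ f))
               (ℤₚ.+-monoˡ-≤ (- + 1) Σ≤fuel))

    unfireApex : ℕ → Vec (suc m) → Vec (suc m)
    unfireApex c x i = x i - + c * L i zero

    unfireApex-ImRel : ∀ c x → ImRel L x (unfireApex c x)
    unfireApex-ImRel c x = (λ j → + c * basis zero j) , λ i →
      trans (solve 2 (λ x y → x :- (x :- y) := y) refl (x i) (+ c * L i zero))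
            (sym (trans (·ᵛ-* L (+ c) (basis zero) i) (cong (+ c *_) (·ᵛ-basis L zero i))))

    unfireApex-tail : ∀ c x a → unfireApex c x (suc a) ≡ x (suc a) + + c
    unfireApex-tail c x a =
      trans (cong (_-_ (x (suc a))) (trans (ℤₚ.*-comm (+ c) (+ 0 - + 1)) (ℤₚ.-1*i≡-i (+ c))))
            (cong (_+_ (x (suc a))) (ℤₚ.neg-involutive (+ c)))

    unfireApex-nonNegative : ∀ x → NonNegative (unfireApex (sumFinℕ (λ a → ℤ.∣ x (suc a) ∣)) x)
    unfireApex-nonNegative x a = subst (+ 0 ℤ.≤_) (sym (unfireApex-tail _ x a))
      (0≤i+c (x (suc a)) (term≤sumFinℕ (λ a → ℤ.∣ x (suc a) ∣) a))
      where
      0≤i+c : ∀ i {c} → ℤ.∣ i ∣ ≤ c → + 0 ℤ.≤ i + + c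
      0≤i+c (+ n)      _    = +≤+ z≤n
      0≤i+c -[1+ n ] n<c = subst (+ 0 ℤ.≤_) (sym (ℤₚ.⊖-≥ n<c)) (+≤+ z≤n)

    stabilize : ∀ x → Stabilizable x
    stabilize x =
      let r , shifted~r , r-stable = stabilize-nonNegative ℤ.∣ tailSum shifted ∣ shifted shifted≥0 Σ≤∣Σ∣
      in  r , ImRel-trans L {x} {shifted} {r} (unfireApex-ImRel c x) shifted~r , r-stable
      where
      c : ℕ
      c = sumFinℕ (λ a → ℤ.∣ x (suc a) ∣)
      shifted : Vec (suc m)
      shifted = unfireApex c x
      shifted≥0 : NonNegative shifted
      shifted≥0 = unfireApex-nonNegative x
      Σ≤∣Σ∣ : tailSum shifted ℤ.≤ + ℤ.∣ tailSum shifted ∣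
      Σ≤∣Σ∣ = ℤₚ.≤-reflexive (sym (ℤₚ.0≤i⇒+∣i∣≡i (sumFin-nonneg _ shifted≥0)))

    -- Any common bound on the degrees would do.
    chipBound : ℕ
    chipBound = suc (sumFinℕ (λ a → sumFinℕ (A a)))

    stable-chips : ∀ r → Stable r → ∀ a → ℤ.∣ r (suc a) ∣ < chipBound
    stable-chips r r-stable a = ℕₚ.<-≤-trans (ℤₚ.drop‿+<+ ∣r∣<deg) (s≤s (term≤sumFinℕ (λ a → sumFinℕ (A a)) a))
      where
      ∣r∣<deg : + ℤ.∣ r (suc a) ∣ ℤ.< + suc (sumFinℕ (A a))
      ∣r∣<deg = subst (ℤ._< + suc (sumFinℕ (A a))) (sym (ℤₚ.0≤i⇒+∣i∣≡i (proj₁ (r-stable a)))) (proj₂ (r-stable a))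

    stable-unique : ∀ r r' → Stable r → Stable r' → sumFin r ≡ + 0 → sumFin r' ≡ + 0 →
      (∀ a → ℤ.∣ r (suc a) ∣ ≡ ℤ.∣ r' (suc a) ∣) → ∀ i → r i ≡ r' i
    stable-unique r r' r-stable r'-stable Σr≡0 Σr'≡0 ∣r∣≡∣r'∣ = pointwise
      where
      tail : ∀ a → r (suc a) ≡ r' (suc a)
      tail a = trans (sym (ℤₚ.0≤i⇒+∣i∣≡i (proj₁ (r-stable a))))
                     (trans (cong +_ (∣r∣≡∣r'∣ a)) (ℤₚ.0≤i⇒+∣i∣≡i (proj₁ (r'-stable a))))
      pointwise : ∀ i → r i ≡ r' i
      pointwise zero    = trans (head≡-sumTail r Σr≡0) (trans (cong -_ (sumFin-cong tail)) (sym (head≡-sumTail r' Σr'≡0)))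
      pointwise (suc a) = tail a

    chipCode : ∀ r → Stable r → Fin (chipBound ^ m)
    chipCode r r-stable = funToFin (λ a → fromℕ< (stable-chips r r-stable a))

    chipCode-injective : ∀ r r' (r-stable : Stable r) (r'-stable : Stable r') → sumFin r ≡ + 0 → sumFin r' ≡ + 0 →
      chipCode r r-stable ≡ chipCode r' r'-stable → ∀ i → r i ≡ r' i
    chipCode-injective r r' r-stable r'-stable Σr≡0 Σr'≡0 same = stable-unique r r' r-stable r'-stable Σr≡0 Σr'≡0 λ a → begin
      ℤ.∣ r (suc a) ∣                               ≡⟨ decode r r-stable a ⟨
      toℕ (finToFun (chipCode r r-stable) a)        ≡⟨ cong (λ c → toℕ (finToFun c a)) same ⟩
      toℕ (finToFun (chipCode r' r'-stable) a)      ≡⟨ decode r' r'-stable a ⟩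
      ℤ.∣ r' (suc a) ∣ ∎
      where
      open ≡-Reasoning
      decode : ∀ r r-stable a → toℕ (finToFun (chipCode r r-stable) a) ≡ ℤ.∣ r (suc a) ∣
      decode r r-stable a = trans (cong toℕ (Finₚ.finToFun-funToFin _ a)) (Finₚ.toℕ-fromℕ< _)

    sum≡0⇒IsTorsion : ∀ x → sumFin x ≡ + 0 → IsTorsion L x
    sum≡0⇒IsTorsion x Σx≡0 = torsion (Finₚ.pigeonhole (ℕₚ.n<1+n (chipBound ^ m)) code)
      where
      Multiplier : Set
      Multiplier = Fin (suc (chipBound ^ m))

      multiple : Multiplier → Vec (suc m)
      multiple q i = + suc (toℕ q) * x i

      reduct : Multiplier → Vec (suc m)
      reduct q = proj₁ (stabilize (multiple q))

      reduct~ : ∀ q → ImRel L (multiple q) (reduct q)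
      reduct~ q = proj₁ (proj₂ (stabilize (multiple q)))

      reduct-stable : ∀ q → Stable (reduct q)
      reduct-stable q = proj₂ (proj₂ (stabilize (multiple q)))

      reduct-sum : ∀ q → sumFin (reduct q) ≡ + 0
      reduct-sum q = begin
        sumFin (reduct q)
          ≡⟨ sym (ImRel-laplacian⇒sum≡ (cone A) (cone-symmetric A A-sym) (multiple q) (reduct q) (reduct~ q)) ⟩
        sumFin (multiple q)                 ≡⟨ sumFin-*ˡ (+ suc (toℕ q)) x ⟩
        + suc (toℕ q) * sumFin x            ≡⟨ cong (+ suc (toℕ q) *_) Σx≡0 ⟩
        + suc (toℕ q) * + 0                 ≡⟨ ℤₚ.*-zeroʳ (+ suc (toℕ q)) ⟩
        + 0 ∎
        where open ≡-Reasoning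

      code : Multiplier → Fin (chipBound ^ m)
      code q = chipCode (reduct q) (reduct-stable q)

      same-reduct : ∀ q₁ q₂ → code q₁ ≡ code q₂ → ∀ i → reduct q₂ i ≡ reduct q₁ i
      same-reduct q₁ q₂ same i = sym (chipCode-injective (reduct q₁) (reduct q₂) (reduct-stable q₁) (reduct-stable q₂)
                                                         (reduct-sum q₁) (reduct-sum q₂) same i)

      torsion : ∃₂ (λ q₁ q₂ → q₁ F.< q₂ × code q₁ ≡ code q₂) → IsTorsion L x
      torsion (q₁ , q₂ , q₁<q₂ , same) = ImRel-multiples⇒IsTorsion L x (s≤s q₁<q₂)
        (ImRel-trans L {multiple q₂} {reduct q₂} {multiple q₁} (reduct~ q₂)
          (ImRel-trans L {reduct q₂} {reduct q₁} {multiple q₁}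
            (ImRel-reflexive L (same-reduct q₁ q₂ same)) (ImRel-sym L {multiple q₁} {reduct q₁} (reduct~ q₁))))

  module Residues (n : ℕ) .{{_ : ℕ.NonZero n}} where

    residue : ℕ → Fin n
    residue a = fromℕ< (ℕ.m%n<n a n)

    toℕ-residue : ∀ a → toℕ (residue a) ≡ a % n
    toℕ-residue a = Finₚ.toℕ-fromℕ< (ℕ.m%n<n a n)

    residue-cong : ∀ {a b} → a % n ≡ b % n → residue a ≡ residue b
    residue-cong {a} {b} a≡b = Finₚ.toℕ-injective (trans (toℕ-residue a) (trans a≡b (sym (toℕ-residue b))))

    residue-toℕ : ∀ (i : Fin n) → residue (toℕ i) ≡ i
    residue-toℕ i = Finₚ.toℕ-injective (trans (toℕ-residue (toℕ i)) (ℕ.m<n⇒m%n≡m (Finₚ.toℕ<n i)))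

    residue-+n : ∀ a → residue (a ℕ.+ n) ≡ residue a
    residue-+n a = residue-cong (ℕ.[m+n]%n≡m%n a n)

    %-+ˡ : ∀ a b → ((a % n) ℕ.+ b) % n ≡ (a ℕ.+ b) % n
    %-+ˡ a b = begin
      ((a % n) ℕ.+ b) % n           ≡⟨ ℕ.%-distribˡ-+ (a % n) b n ⟩
      ((a % n % n) ℕ.+ (b % n)) % n ≡⟨ cong (λ z → (z ℕ.+ (b % n)) % n) (ℕ.m%n%n≡m%n a n) ⟩
      ((a % n) ℕ.+ (b % n)) % n     ≡⟨ ℕ.%-distribˡ-+ a b n ⟨
      (a ℕ.+ b) % n ∎
      where open ≡-Reasoning

    residue-+ : ∀ a b → residue (toℕ (residue a) ℕ.+ b) ≡ residue (a ℕ.+ b)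
    residue-+ a b = residue-cong (trans (cong (λ z → (z ℕ.+ b) % n) (toℕ-residue a)) (%-+ˡ a b))

    residue-+-∸ : ∀ a t → t ≤ n → (toℕ (residue (a ℕ.+ (n ∸ t))) ℕ.+ t) % n ≡ a % n
    residue-+-∸ a t t≤n = begin
      (toℕ (residue (a ℕ.+ (n ∸ t))) ℕ.+ t) % n ≡⟨ cong (λ z → (z ℕ.+ t) % n) (toℕ-residue (a ℕ.+ (n ∸ t))) ⟩
      (((a ℕ.+ (n ∸ t)) % n) ℕ.+ t) % n         ≡⟨ %-+ˡ (a ℕ.+ (n ∸ t)) t ⟩
      ((a ℕ.+ (n ∸ t)) ℕ.+ t) % n
        ≡⟨ cong (_% n) (trans (ℕₚ.+-assoc a (n ∸ t) t) (cong (a ℕ.+_) (ℕₚ.m∸n+n≡m t≤n))) ⟩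
      (a ℕ.+ n) % n                             ≡⟨ ℕ.[m+n]%n≡m%n a n ⟩
      a % n ∎
      where open ≡-Reasoning

    residue-+-∸-unique : ∀ (i j : Fin n) t → t ≤ n → (toℕ j ℕ.+ t) % n ≡ toℕ i → j ≡ residue (toℕ i ℕ.+ (n ∸ t))
    residue-+-∸-unique i j t t≤n j+t≡i = Finₚ.toℕ-injective (sym (begin
      toℕ (residue (toℕ i ℕ.+ (n ∸ t)))           ≡⟨ toℕ-residue (toℕ i ℕ.+ (n ∸ t)) ⟩
      (toℕ i ℕ.+ (n ∸ t)) % n                     ≡⟨ cong (λ z → (z ℕ.+ (n ∸ t)) % n) j+t≡i ⟨
      (((toℕ j ℕ.+ t) % n) ℕ.+ (n ∸ t)) % n       ≡⟨ %-+ˡ (toℕ j ℕ.+ t) (n ∸ t) ⟩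
      ((toℕ j ℕ.+ t) ℕ.+ (n ∸ t)) % n             ≡⟨ cong (_% n) (trans (ℕₚ.+-assoc (toℕ j) t (n ∸ t))
                                                       (cong (toℕ j ℕ.+_) (ℕₚ.m+[n∸m]≡n t≤n))) ⟩
      (toℕ j ℕ.+ n) % n                           ≡⟨ ℕ.[m+n]%n≡m%n (toℕ j) n ⟩
      toℕ j % n                                   ≡⟨ ℕ.m<n⇒m%n≡m (Finₚ.toℕ<n j) ⟩
      toℕ j ∎))
      where open ≡-Reasoning

  module Circulant (n' : ℕ) {k : ℕ} (s : Fin k → ℕ) (s≤n : ∀ l → s l ≤ suc n') where

    n : ℕ
    n = suc n'

    instance
      n-nonZero : ℕ.NonZero n
      n-nonZero = _

    open Residues n public

    C : AdjMatrix n
    C = circulant n s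

    forward backward : Fin n → Fin k → Fin n
    forward  i l = residue (toℕ i ℕ.+ s l)
    backward i l = residue (toℕ i ℕ.+ (n ∸ s l))

    circulant-·ᵛ : ∀ i (g : Fin n → ℤ) → sumFin (λ j → + C i j * g j) ≡ sumFin (λ l → g (forward i l) + g (backward i l))
    circulant-·ᵛ i g = begin
      sumFin (λ j → + C i j * g j)
        ≡⟨ sumFin-cong (λ j → trans (cong (_* g j) (entry j)) (sym (sumFin-*ʳ (g j) (λ l → isForward l j + isBackward l j)))) ⟩
      sumFin (λ j → sumFin (λ l → (isForward l j + isBackward l j) * g j))
        ≡⟨ sumFin-swap (λ j l → (isForward l j + isBackward l j) * g j) ⟩
      sumFin (λ l → sumFin (λ j → (isForward l j + isBackward l j) * g j))
        ≡⟨ sumFin-cong (λ l → trans (sumFin-cong (λ j → ℤₚ.*-distribʳ-+ (g j) (isForward l j) (isBackward l j)))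
             (trans (sumFin-+ (λ j → isForward l j * g j) (λ j → isBackward l j * g j))
                    (cong₂ _+_ (sumFin-indicator (isForward l) g (forward i l) (forward₁ l) (forward₀ l))
                               (sumFin-indicator (isBackward l) g (backward i l) (backward₁ l) (backward₀ l))))) ⟩
      sumFin (λ l → g (forward i l) + g (backward i l)) ∎
      where
      open ≡-Reasoning
      isForward isBackward : Fin k → Fin n → ℤ
      isForward  l j = + bool→ℕ (((toℕ i ℕ.+ s l) % n) ≡ᵇ toℕ j)
      isBackward l j = + bool→ℕ (((toℕ j ℕ.+ s l) % n) ≡ᵇ toℕ i)
      entry : ∀ j → + C i j ≡ sumFin (λ l → isForward l j + isBackward l j)
      entry j = trans (sumFinℕ-toℤ (λ l → bool→ℕ (((toℕ i ℕ.+ s l) % n) ≡ᵇ toℕ j)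
                                        ℕ.+ bool→ℕ (((toℕ j ℕ.+ s l) % n) ≡ᵇ toℕ i)))
        (sumFin-cong (λ l → ℤₚ.pos-+ (bool→ℕ (((toℕ i ℕ.+ s l) % n) ≡ᵇ toℕ j)) _))
      forward₁ : ∀ l → isForward l (forward i l) ≡ + 1
      forward₁ l rewrite toℕ-residue (toℕ i ℕ.+ s l) | ≡ᵇ-≡ {(toℕ i ℕ.+ s l) % n} refl = refl
      forward₀ : ∀ l j → j ≢ forward i l → isForward l j ≡ + 0
      forward₀ l j j≢ rewrite ≡ᵇ-≢ (λ eq → j≢ (Finₚ.toℕ-injective (trans (sym eq) (sym (toℕ-residue (toℕ i ℕ.+ s l))))))
        = refl
      backward₁ : ∀ l → isBackward l (backward i l) ≡ + 1
      backward₁ l rewrite residue-+-∸ (toℕ i) (s l) (s≤n l) | ℕ.m<n⇒m%n≡m (Finₚ.toℕ<n i) | ≡ᵇ-≡ {toℕ i} refl = refl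
      backward₀ : ∀ l j → j ≢ backward i l → isBackward l j ≡ + 0
      backward₀ l j j≢ rewrite ≡ᵇ-≢ (λ eq → j≢ (residue-+-∸-unique i j (s l) (s≤n l) eq)) = refl

    circulant-symmetric : Symmetric C
    circulant-symmetric i j = sumFinℕ-cong (λ l → ℕₚ.+-comm (bool→ℕ (((toℕ i ℕ.+ s l) % n) ≡ᵇ toℕ j)) _)

    cone-degree : ∀ i → degree (cone C) (suc i) ≡ + (2 ℕ.* k ℕ.+ 1)
    cone-degree i = trans (cong (λ d → + suc d) (trans (ℤₚ.+-injective circulant-degree) (ℕₚ.*-comm k 2)))
                        (cong +_ (ℕₚ.+-comm 1 (2 ℕ.* k)))
      where
      circulant-degree : + sumFinℕ (C i) ≡ + (k ℕ.* 2)
      circulant-degree = begin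
        + sumFinℕ (C i)               ≡⟨ sumFinℕ-toℤ (C i) ⟩
        sumFin (λ j → + C i j)        ≡⟨ sumFin-cong (λ j → sym (ℤₚ.*-identityʳ (+ C i j))) ⟩
        sumFin (λ j → + C i j * + 1)  ≡⟨ circulant-·ᵛ i (λ _ → + 1) ⟩
        sumFin {k} (λ l → + 2)        ≡⟨ sumFin-const k (+ 2) ⟩
        + k * + 2                     ≡⟨ ℤₚ.pos-* k 2 ⟨
        + (k ℕ.* 2) ∎
        where open ≡-Reasoning

    relative : Vec (suc n) → ℕ → ℤ
    relative v a = v (suc (residue a)) - v zero

    relative-+n : ∀ v a → relative v (a ℕ.+ n) ≡ relative v a
    relative-+n v a = cong (λ z → v (suc z) - v zero) (residue-+n a)

    cone-laplacian-·ᵛ : ∀ (v : Vec (suc n)) i →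
      (laplacian (cone C) ·ᵛ v) (suc i) ≡
        + (2 ℕ.* k ℕ.+ 1) * relative v (toℕ i)
        - sumFin (λ l → relative v (toℕ i ℕ.+ s l) + relative v (toℕ i ℕ.+ (n ∸ s l)))
    cone-laplacian-·ᵛ v i = begin
      (laplacian (cone C) ·ᵛ v) (suc i)
        ≡⟨ laplacian-·ᵛ (cone C) v (suc i) ⟩
      degree (cone C) (suc i) * v (suc i) - (+ 1 * v zero + sumFin (λ j → + C i j * v (suc j)))
        ≡⟨ cong₂ (λ d a → d * v (suc i) - (a + sumFin (λ j → + C i j * v (suc j)))) (cone-degree i) (ℤₚ.*-identityˡ (v zero)) ⟩
      d * v (suc i) - (v zero + sumFin (λ j → + C i j * v (suc j)))
        ≡⟨ cong (λ z → d * v (suc i) - (v zero + z)) (circulant-·ᵛ i (λ j → v (suc j))) ⟩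
      d * v (suc i) - (v zero + sumFin (λ l → vf l + vb l))
        ≡⟨ cong (λ d → d * v (suc i) - (v zero + sumFin (λ l → vf l + vb l))) d≡2k+1 ⟩
      (+ 2 * + k + + 1) * v (suc i) - (v zero + sumFin (λ l → vf l + vb l))
        ≡⟨ solve 4 (λ v v₀ S k → (con (+ 2) :* k :+ con (+ 1)) :* v :- (v₀ :+ S)
                         := (con (+ 2) :* k :+ con (+ 1)) :* (v :- v₀) :- (S :- k :* (con (+ 2) :* v₀))) refl
             (v (suc i)) (v zero) (sumFin (λ l → vf l + vb l)) (+ k) ⟩
      (+ 2 * + k + + 1) * (v (suc i) - v zero) - (sumFin (λ l → vf l + vb l) - + k * (+ 2 * v zero))
        ≡⟨ cong₂ (λ a b → (+ 2 * + k + + 1) * (v (suc a) - v zero) - b) (sym (residue-toℕ i))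
             (trans (cong (_-_ (sumFin (λ l → vf l + vb l))) (sym (sumFin-const k (+ 2 * v zero))))
                    (sym (sumFin-- (λ l → vf l + vb l) (λ _ → + 2 * v zero)))) ⟩
      (+ 2 * + k + + 1) * relative v (toℕ i) - sumFin (λ l → (vf l + vb l) - + 2 * v zero)
        ≡⟨ cong₂ (λ d z → d * relative v (toℕ i) - z) (sym d≡2k+1) (sumFin-cong (λ l →
             solve 3 (λ a b c → (a :+ b) :- con (+ 2) :* c := (a :- c) :+ (b :- c)) refl (vf l) (vb l) (v zero))) ⟩
      d * relative v (toℕ i) - sumFin (λ l → relative v (toℕ i ℕ.+ s l) + relative v (toℕ i ℕ.+ (n ∸ s l))) ∎
      where
      open ≡-Reasoning
      d : ℤ
      d = + (2 ℕ.* k ℕ.+ 1)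
      d≡2k+1 : d ≡ + 2 * + k + + 1
      d≡2k+1 = trans (ℤₚ.pos-+ (2 ℕ.* k) 1) (cong (_+ + 1) (ℤₚ.pos-* 2 k))
      vf vb : Fin k → ℤ
      vf l = v (suc (forward i l))
      vb l = v (suc (backward i l))

  indicator : ℤ → ℤ → ℤ
  indicator x z = + bool→ℕ ⌊ x ℤ.≟ z ⌋

  indicator-≡ : ∀ {x z} → x ≡ z → indicator x z ≡ + 1
  indicator-≡ {x} {z} x≡z with x ℤ.≟ z
  ... | yes _   = refl
  ... | no  x≢z = ⊥-elim (x≢z x≡z)

  indicator-≢ : ∀ {x z} → x ≢ z → indicator x z ≡ + 0
  indicator-≢ {x} {z} x≢z with x ℤ.≟ z
  ... | yes x≡z = ⊥-elim (x≢z x≡z)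
  ... | no  _   = refl

  circPolyCoeff-indicators : ∀ {k} (s : Fin k → ℕ) e → circPolyCoeff s e ≡
    indicator e (+ 0) * + (2 ℕ.* k ℕ.+ 1) - sumFin (λ l → indicator e (+ s l) + indicator e (- + s l))
  circPolyCoeff-indicators {k} s e = cong₂ _-_ centre
    (trans (sumFinℕ-toℤ (λ l → bool→ℕ ⌊ e ℤ.≟ + s l ⌋ ℕ.+ bool→ℕ ⌊ e ℤ.≟ - + s l ⌋))
           (sumFin-cong (λ l → ℤₚ.pos-+ (bool→ℕ ⌊ e ℤ.≟ + s l ⌋) _)))
    where
    centre : (if ⌊ e ℤ.≟ + 0 ⌋ then + (2 ℕ.* k ℕ.+ 1) else + 0) ≡ indicator e (+ 0) * + (2 ℕ.* k ℕ.+ 1)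
    centre with e ℤ.≟ + 0
    ... | yes _ = sym (ℤₚ.*-identityˡ _)
    ... | no  _ = refl

  -- Coefficients of 2k+1 − Σ (z^{s_l} + z^{−s_l}), multiplied by z^S and indexed from 0.
  module CirculantPolynomial {k} (s : Fin k → ℕ) (S : ℕ) (s≤S : ∀ l → s l ≤ S) where

    exponent : ℕ → ℤ
    exponent j = - + S + + j

    coefficient : ℕ → ℤ
    coefficient j = circPolyCoeff s (exponent j)

    exponent-injective : ∀ {i j} → exponent i ≡ exponent j → i ≡ j
    exponent-injective {i} {j} eq = ℤₚ.+-injective (begin
      + i                  ≡⟨ solve 2 (λ S i → i := S :+ (:- S :+ i)) refl (+ S) (+ i) ⟩
      + S + exponent i     ≡⟨ cong (_+_ (+ S)) eq ⟩
      + S + exponent j     ≡⟨ solve 2 (λ S j → S :+ (:- S :+ j) := j) refl (+ S) (+ j) ⟩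
      + j ∎)
      where open ≡-Reasoning

    sum-indicator-exponent : ∀ {N} (h : ℕ → ℤ) a z → a < N → exponent a ≡ z →
      sumFin {N} (λ j → indicator (exponent (toℕ j)) z * h (toℕ j)) ≡ h a
    sum-indicator-exponent h a z a<N a↦z =
      sumFin-indicatorℕ (λ j → indicator (exponent j) z) h a a<N (indicator-≡ a↦z)
        (λ j j≢a → indicator-≢ (λ j↦z → j≢a (exponent-injective (trans j↦z (sym a↦z)))))

    exponent-+ : ∀ c → exponent (S ℕ.+ c) ≡ + c
    exponent-+ c = trans (cong (_+_ (- + S)) (ℤₚ.pos-+ S c)) (solve 2 (λ S c → :- S :+ (S :+ c) := c) refl (+ S) (+ c))

    exponent-∸ : ∀ c → c ≤ S → exponent (S ∸ c) ≡ - + c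
    exponent-∸ c c≤S = begin
      - + S + + (S ∸ c)
        ≡⟨ cong (λ z → - z + + (S ∸ c)) (trans (cong +_ (sym (ℕₚ.m∸n+n≡m c≤S))) (ℤₚ.pos-+ (S ∸ c) c)) ⟩
      - (+ (S ∸ c) + + c) + + (S ∸ c)
        ≡⟨ solve 2 (λ x c → :- (x :+ c) :+ x := :- c) refl (+ (S ∸ c)) (+ c) ⟩
      - + c ∎
      where open ≡-Reasoning

    coefficient-sum : ∀ {N} → 2 ℕ.* S < N → ∀ (h : ℕ → ℤ) →
      sumFin {N} (λ j → coefficient (toℕ j) * h (toℕ j)) ≡
        + (2 ℕ.* k ℕ.+ 1) * h S - sumFin (λ l → h (S ℕ.+ s l) + h (S ∸ s l))
    coefficient-sum {N} 2S<N h = begin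
      sumFin {N} (λ j → coefficient (toℕ j) * h (toℕ j))
        ≡⟨ sumFin-cong {N} (λ j → trans (cong (_* h (toℕ j)) (circPolyCoeff-indicators s (exponent (toℕ j))))
             (solve 4 (λ i d e h → (i :* d :- e) :* h := i :* (d :* h) :- e :* h) refl
                (centre (toℕ j)) d (sides (toℕ j)) (h (toℕ j)))) ⟩
      sumFin {N} (λ j → centre (toℕ j) * (d * h (toℕ j)) - sides (toℕ j) * h (toℕ j))
        ≡⟨ sumFin-- {N} (λ j → centre (toℕ j) * (d * h (toℕ j))) (λ j → sides (toℕ j) * h (toℕ j)) ⟩
      sumFin {N} (λ j → centre (toℕ j) * (d * h (toℕ j))) - sumFin {N} (λ j → sides (toℕ j) * h (toℕ j))
        ≡⟨ cong₂ _-_ (sum-indicator-exponent (λ j → d * h j) S (+ 0) S<N (ℤₚ.+-inverseˡ (+ S))) sides-sum ⟩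
      d * h S - sumFin (λ l → h (S ℕ.+ s l) + h (S ∸ s l)) ∎
      where
      open ≡-Reasoning
      d : ℤ
      d = + (2 ℕ.* k ℕ.+ 1)
      centre : ℕ → ℤ
      centre j = indicator (exponent j) (+ 0)
      up down side : Fin k → ℕ → ℤ
      up   l j = indicator (exponent j) (+ s l)
      down l j = indicator (exponent j) (- + s l)
      side l j = up l j + down l j
      sides : ℕ → ℤ
      sides j = sumFin (λ l → side l j)
      S<N : S < N
      S<N = ℕₚ.≤-<-trans (ℕₚ.m≤m+n S (S ℕ.+ 0)) 2S<N
      S+s<N : ∀ l → S ℕ.+ s l < N
      S+s<N l = ℕₚ.≤-<-trans (ℕₚ.+-monoʳ-≤ S (ℕₚ.≤-trans (s≤S l) (ℕₚ.m≤m+n S 0))) 2S<N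
      S∸s<N : ∀ l → S ∸ s l < N
      S∸s<N l = ℕₚ.≤-<-trans (ℕₚ.m∸n≤m S (s l)) S<N
      side-sum : ∀ l → sumFin {N} (λ j → side l (toℕ j) * h (toℕ j)) ≡ h (S ℕ.+ s l) + h (S ∸ s l)
      side-sum l =
        trans (sumFin-cong {N} (λ j → ℤₚ.*-distribʳ-+ (h (toℕ j)) (up l (toℕ j)) (down l (toℕ j))))
       (trans (sumFin-+ {N} (λ j → up l (toℕ j) * h (toℕ j)) (λ j → down l (toℕ j) * h (toℕ j)))
              (cong₂ _+_ (sum-indicator-exponent h (S ℕ.+ s l) (+ s l) (S+s<N l) (exponent-+ (s l)))
                         (sum-indicator-exponent h (S ∸ s l) (- + s l) (S∸s<N l) (exponent-∸ (s l) (s≤S l)))))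
      sides-sum : sumFin {N} (λ j → sides (toℕ j) * h (toℕ j)) ≡ sumFin (λ l → h (S ℕ.+ s l) + h (S ∸ s l))
      sides-sum =
        trans (sumFin-cong {N} (λ j → sym (sumFin-*ʳ (h (toℕ j)) (λ l → side l (toℕ j)))))
       (trans (sumFin-swap {N} (λ j l → side l (toℕ j) * h (toℕ j))) (sumFin-cong side-sum))

  -+m≢+n : ∀ {m n} → 0 < m → - + m ≢ + n
  -+m≢+n {suc m} _ ()

  +m≢-+n : ∀ {m n} → 0 < m → + m ≢ - + n
  +m≢-+n {suc m} {zero}  _ ()
  +m≢-+n {suc m} {suc n} _ ()

  module ExtremeCoefficients {k} (s : Fin k → ℕ) (S : ℕ) (s≤S : ∀ l → s l ≤ S) (0<S : 0 < S)
      (top : Fin k) (s-top : s top ≡ S) (top-unique : ∀ l → s l ≡ S → l ≡ top) where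

    open CirculantPolynomial s S s≤S

    extreme-coefficient : ∀ j {e} → exponent j ≡ e → e ≢ + 0 →
      indicator e (+ s top) + indicator e (- + s top) ≡ + 1 →
      (∀ l → l ≢ top → indicator e (+ s l) + indicator e (- + s l) ≡ + 0) →
      coefficient j ≡ - + 1
    extreme-coefficient j {e} j↦e e≢0 side-top side-other = begin
      coefficient j
        ≡⟨ trans (cong (circPolyCoeff s) j↦e) (circPolyCoeff-indicators s e) ⟩
      indicator e (+ 0) * + (2 ℕ.* k ℕ.+ 1) - sumFin side
        ≡⟨ cong₂ (λ c t → c * + (2 ℕ.* k ℕ.+ 1) - t) (indicator-≢ e≢0) sides ⟩
      + 0 * + (2 ℕ.* k ℕ.+ 1) - + 1 ≡⟨⟩
      - + 1 ∎
      where
      open ≡-Reasoning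
      side : Fin k → ℤ
      side l = indicator e (+ s l) + indicator e (- + s l)
      sides : sumFin side ≡ + 1
      sides = trans (sumFin-cong (λ l → sym (ℤₚ.*-identityʳ (side l))))
                    (sumFin-indicator side (λ _ → + 1) top side-top side-other)

    s≢S : ∀ l → l ≢ top → s l ≢ S
    s≢S l l≢top s≡S = l≢top (top-unique l s≡S)

    coefficient-first : coefficient 0 ≡ - + 1
    coefficient-first = extreme-coefficient 0 (ℤₚ.+-identityʳ (- + S)) (-+m≢+n 0<S)
      (cong₂ _+_ (indicator-≢ (-+m≢+n 0<S)) (indicator-≡ (cong (λ c → - + c) (sym s-top))))
      (λ l l≢top → cong₂ _+_ (indicator-≢ (-+m≢+n 0<S))
                             (indicator-≢ (λ eq → s≢S l l≢top (sym (ℤₚ.+-injective (ℤₚ.neg-injective eq))))))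

    coefficient-last : coefficient (2 ℕ.* S) ≡ - + 1
    coefficient-last = extreme-coefficient (2 ℕ.* S) exponent-2S (λ eq → ℕₚ.<⇒≢ 0<S (sym (ℤₚ.+-injective eq)))
      (cong₂ _+_ (indicator-≡ (cong +_ (sym s-top))) (indicator-≢ (+m≢-+n 0<S)))
      (λ l l≢top → cong₂ _+_ (indicator-≢ (λ eq → s≢S l l≢top (sym (ℤₚ.+-injective eq))))
                             (indicator-≢ (+m≢-+n 0<S)))
      where
      exponent-2S : exponent (2 ℕ.* S) ≡ + S
      exponent-2S = trans (exponent-+ (S ℕ.+ 0)) (cong +_ (ℕₚ.+-identityʳ S))

  -- The extreme coefficients are −1, so circCompanion s S is the companion matrix
  -- of the recurrence Σⱼ coefficient j * u (t + j) = 0.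
  module CirculantRecurrence {k} (s : Fin (suc k) → ℕ) (S' : ℕ) (s≤S : ∀ l → s l ≤ suc S')
      (top : Fin (suc k)) (s-top : s top ≡ suc S') (top-unique : ∀ l → s l ≡ suc S' → l ≡ top) where

    S : ℕ
    S = suc S'

    open CirculantPolynomial s S s≤S public
    open ExtremeCoefficients s S s≤S (s≤s z≤n) top s-top top-unique

    -- 2 * S written as suc m, so that the companion matrix has dimension suc m.
    m : ℕ
    m = S' ℕ.+ suc (S' ℕ.+ 0)

    open Companion m (λ i → - + 1 * coefficient i) public

    residual-convolution : ∀ u t → residual u t ≡ - sumFin {suc (2 ℕ.* S)} (λ j → coefficient (toℕ j) * u (t ℕ.+ toℕ j))
    residual-convolution u t = begin
      (u (t ℕ.+ 0) + sumFin {m} (λ j → - + 1 * c (suc (toℕ j)) * u (t ℕ.+ suc (toℕ j)))) + u (t ℕ.+ suc m)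
        ≡⟨ cong (λ z → (u (t ℕ.+ 0) + z) + u (t ℕ.+ suc m)) middle ⟩
      (u (t ℕ.+ 0) + - Σmiddle) + u (t ℕ.+ suc m)
        ≡⟨ solve 3 (λ x y z → (x :+ :- y) :+ z := :- (:- x :+ (y :+ :- z))) refl (u (t ℕ.+ 0)) Σmiddle (u (t ℕ.+ suc m)) ⟩
      - (- u (t ℕ.+ 0) + (Σmiddle + - u (t ℕ.+ suc m)))
        ≡⟨ cong -_ (cong₂ _+_ (sym first) (sym (trans (sumFin-init-last {m} (λ j → f (suc j))) (cong₂ _+_ inner last)))) ⟩
      - sumFin {suc (2 ℕ.* S)} f ∎
      where
      open ≡-Reasoning
      c : ℕ → ℤ
      c = coefficient
      f : Fin (suc (2 ℕ.* S)) → ℤ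
      f j = c (toℕ j) * u (t ℕ.+ toℕ j)
      Σmiddle : ℤ
      Σmiddle = sumFin {m} (λ j → c (suc (toℕ j)) * u (t ℕ.+ suc (toℕ j)))
      middle : sumFin {m} (λ j → - + 1 * c (suc (toℕ j)) * u (t ℕ.+ suc (toℕ j))) ≡ - Σmiddle
      middle = trans (sumFin-cong {m} (λ j → ℤₚ.*-assoc (- + 1) (c (suc (toℕ j))) (u (t ℕ.+ suc (toℕ j)))))
                     (trans (sumFin-*ˡ {m} (- + 1) (λ j → c (suc (toℕ j)) * u (t ℕ.+ suc (toℕ j)))) (ℤₚ.-1*i≡-i Σmiddle))
      first : f zero ≡ - u (t ℕ.+ 0)
      first = trans (cong (_* u (t ℕ.+ 0)) coefficient-first) (ℤₚ.-1*i≡-i (u (t ℕ.+ 0)))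
      inner : sumFin {m} (λ j → f (suc (inject₁ j))) ≡ Σmiddle
      inner = sumFin-cong {m} (λ j → cong (λ z → c (suc z) * u (t ℕ.+ suc z)) (Finₚ.toℕ-inject₁ j))
      last : f (suc (fromℕ m)) ≡ - u (t ℕ.+ suc m)
      last = trans (cong (λ z → c (suc z) * u (t ℕ.+ suc z)) (Finₚ.toℕ-fromℕ m))
                   (trans (cong (_* u (t ℕ.+ suc m)) coefficient-last) (ℤₚ.-1*i≡-i (u (t ℕ.+ suc m))))

    residual-circulant : ∀ u t → residual u t ≡
      - (+ (2 ℕ.* suc k ℕ.+ 1) * u (t ℕ.+ S) - sumFin (λ l → u (t ℕ.+ (S ℕ.+ s l)) + u (t ℕ.+ (S ∸ s l))))
    residual-circulant u t = trans (residual-convolution u t) (cong -_ (coefficient-sum (ℕₚ.n<1+n (2 ℕ.* S)) (λ j → u (t ℕ.+ j))))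

  module CirculantCone (n' : ℕ) {k} (s : Fin (suc k) → ℕ) (S' : ℕ) (s≤S : ∀ l → s l ≤ suc S')
      (top : Fin (suc k)) (s-top : s top ≡ suc S') (top-unique : ∀ l → s l ≡ suc S' → l ≡ top)
      (2S<n : 2 ℕ.* suc S' < suc n') where

    open CirculantRecurrence s S' s≤S top s-top top-unique

    S≤n : S ≤ suc n'
    S≤n = ℕₚ.≤-trans (ℕₚ.m≤m+n S (S ℕ.+ 0)) (ℕₚ.<⇒≤ 2S<n)

    s≤n : ∀ l → s l ≤ suc n'
    s≤n l = ℕₚ.≤-trans (s≤S l) S≤n

    open Circulant n' s s≤n

    L : Matrix (suc n) (suc n)
    L = laplacian (cone C)

    laplacian-residual : ∀ (v : Vec (suc n)) t → (L ·ᵛ v) (suc (residue (t ℕ.+ S))) ≡ - residual (relative v) t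
    laplacian-residual v t = begin
      (L ·ᵛ v) (suc i)
        ≡⟨ cone-laplacian-·ᵛ v i ⟩
      d * relative v (toℕ i) - sumFin (λ l → relative v (toℕ i ℕ.+ s l) + relative v (toℕ i ℕ.+ (n ∸ s l)))
        ≡⟨ cong₂ (λ a b → d * a - b) (cong (λ z → v (suc z) - v zero) (residue-toℕ i))
             (sumFin-cong (λ l → cong₂ _+_ (cong (λ z → v (suc z) - v zero) (forward≡ l))
                                           (cong (λ z → v (suc z) - v zero) (backward≡ l)))) ⟩
      d * relative v (t ℕ.+ S) - sumFin (λ l → relative v (t ℕ.+ (S ℕ.+ s l)) + relative v (t ℕ.+ (S ∸ s l)))
        ≡⟨ sym (ℤₚ.neg-involutive _) ⟩
      - - (d * relative v (t ℕ.+ S) - sumFin (λ l → relative v (t ℕ.+ (S ℕ.+ s l)) + relative v (t ℕ.+ (S ∸ s l))))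
        ≡⟨ cong -_ (sym (residual-circulant (relative v) t)) ⟩
      - residual (relative v) t ∎
      where
      open ≡-Reasoning
      d : ℤ
      d = + (2 ℕ.* suc k ℕ.+ 1)
      i : Fin n
      i = residue (t ℕ.+ S)
      forward≡ : ∀ l → residue (toℕ i ℕ.+ s l) ≡ residue (t ℕ.+ (S ℕ.+ s l))
      forward≡ l = trans (residue-+ (t ℕ.+ S) (s l)) (cong residue (ℕₚ.+-assoc t S (s l)))
      backward≡ : ∀ l → residue (toℕ i ℕ.+ (n ∸ s l)) ≡ residue (t ℕ.+ (S ∸ s l))
      backward≡ l = trans (residue-+ (t ℕ.+ S) (n ∸ s l)) (trans (cong residue rearrange) (residue-+n (t ℕ.+ (S ∸ s l))))
        where
        rearrange : t ℕ.+ S ℕ.+ (n ∸ s l) ≡ t ℕ.+ (S ∸ s l) ℕ.+ n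
        rearrange = begin
          t ℕ.+ S ℕ.+ (n ∸ s l)                 ≡⟨ cong (λ z → t ℕ.+ z ℕ.+ (n ∸ s l)) (sym (ℕₚ.m∸n+n≡m (s≤S l))) ⟩
          t ℕ.+ ((S ∸ s l) ℕ.+ s l) ℕ.+ (n ∸ s l) ≡⟨ swap t (S ∸ s l) (s l) (n ∸ s l) ⟩
          t ℕ.+ (S ∸ s l) ℕ.+ ((n ∸ s l) ℕ.+ s l) ≡⟨ cong (t ℕ.+ (S ∸ s l) ℕ.+_) (ℕₚ.m∸n+n≡m (s≤n l)) ⟩
          t ℕ.+ (S ∸ s l) ℕ.+ n ∎
          where
          swap : ∀ t x s y → t ℕ.+ (x ℕ.+ s) ℕ.+ y ≡ t ℕ.+ x ℕ.+ (y ℕ.+ s)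
          swap = solve-∀

    𝒩 : Matrix (suc m) (suc m)
    𝒩 = (𝒜 ^ᴹ n) -ᴹ identity

    𝒩-·ᵛ : ∀ w i → (𝒩 ·ᵛ w) i ≡ ((𝒜 ^ᴹ n) ·ᵛ w) i - w i
    𝒩-·ᵛ w i = trans (-ᴹ-·ᵛ (𝒜 ^ᴹ n) identity w i) (cong (_-_ (((𝒜 ^ᴹ n) ·ᵛ w) i)) (identity-·ᵛ w i))

    𝟎 : Vec (suc m)
    𝟎 _ = + 0

    forcing : Vec (suc n) → ℕ → ℤ
    forcing x t = x (suc (residue (t ℕ.+ S)))

    forcing-periodic : ∀ x t → forcing x (t ℕ.+ n) ≡ forcing x t
    forcing-periodic x t = cong (λ z → x (suc z)) (trans (cong residue (reorder t n S)) (residue-+n (t ℕ.+ S)))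
      where
      reorder : ∀ t n S → t ℕ.+ n ℕ.+ S ≡ t ℕ.+ S ℕ.+ n
      reorder = solve-∀

    φ : Vec (suc n) → Vec (suc m)
    φ x = orbit 𝟎 (forcing x) n

    φ-+ : ∀ x y i → φ (x +ᵛ y) i ≡ φ x i + φ y i
    φ-+ x y = orbit-+ 𝟎 𝟎 (forcing x) (forcing y) n

    φ-- : ∀ x y i → φ x i - φ y i ≡ orbit 𝟎 (λ t → forcing x t - forcing y t) n i
    φ-- x y i = sym (orbit-- 𝟎 𝟎 (forcing x) (forcing y) n i)

    orbit-solution : ∀ u Y → (∀ t → t < n → residual u t + Y t ≡ + 0) →
      ∀ i → orbit 𝟎 Y n i ≡ window u n i - ((𝒜 ^ᴹ n) ·ᵛ window u 0) i
    orbit-solution u Y solves i = begin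
      orbit 𝟎 Y n i
        ≡⟨ solve 2 (λ a b → a := b :- (b :- a)) refl (orbit 𝟎 Y n i) (window u n i) ⟩
      window u n i - (window u n i - orbit 𝟎 Y n i)
        ≡⟨ cong (_-_ (window u n i)) (solution-orbit-difference u Y 𝟎 n solves i) ⟩
      window u n i - ((𝒜 ^ᴹ n) ·ᵛ (λ j → window u 0 j - + 0)) i
        ≡⟨ cong (_-_ (window u n i)) (·ᵛ-cong (𝒜 ^ᴹ n) (λ j → ℤₚ.+-identityʳ (window u 0 j)) i) ⟩
      window u n i - ((𝒜 ^ᴹ n) ·ᵛ window u 0) i ∎
      where open ≡-Reasoning

    φ-laplacian : ∀ v → ImRel 𝒩 (φ (L ·ᵛ v)) 𝟎
    φ-laplacian v = (λ j → - window u 0 j) , λ i → begin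
      φ (L ·ᵛ v) i - + 0
        ≡⟨ ℤₚ.+-identityʳ _ ⟩
      φ (L ·ᵛ v) i
        ≡⟨ orbit-solution u (forcing (L ·ᵛ v)) (λ t _ → solves t) i ⟩
      window u n i - ((𝒜 ^ᴹ n) ·ᵛ window u 0) i
        ≡⟨ cong (_- ((𝒜 ^ᴹ n) ·ᵛ window u 0) i) (periodic i) ⟩
      window u 0 i - ((𝒜 ^ᴹ n) ·ᵛ window u 0) i
        ≡⟨ solve 2 (λ a b → a :- b := :- b :- :- a) refl (window u 0 i) (((𝒜 ^ᴹ n) ·ᵛ window u 0) i) ⟩
      - ((𝒜 ^ᴹ n) ·ᵛ window u 0) i - - window u 0 i
        ≡⟨ cong (_- - window u 0 i) (sym (·ᵛ-neg (𝒜 ^ᴹ n) (window u 0) i)) ⟩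
      ((𝒜 ^ᴹ n) ·ᵛ (λ j → - window u 0 j)) i - - window u 0 i
        ≡⟨ sym (𝒩-·ᵛ (λ j → - window u 0 j) i) ⟩
      (𝒩 ·ᵛ (λ j → - window u 0 j)) i ∎
      where
      open ≡-Reasoning
      u : ℕ → ℤ
      u = relative v
      solves : ∀ t → residual u t + forcing (L ·ᵛ v) t ≡ + 0
      solves t = trans (cong (_+_ (residual u t)) (laplacian-residual v t)) (ℤₚ.+-inverseʳ (residual u t))
      periodic : ∀ i → window u n i ≡ window u 0 i
      periodic i = trans (cong u (ℕₚ.+-comm n (toℕ i))) (relative-+n v (toℕ i))

    φ-cong : ∀ x y → ImRel L x y → ImRel 𝒩 (φ x) (φ y)
    φ-cong x y (v , x-y≡Lv) = ImRel-difference 𝒩 {φ x} {φ y}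
      (ImRel-trans 𝒩 {λ i → φ x i - φ y i} {φ (L ·ᵛ v)} {𝟎}
        (ImRel-reflexive 𝒩 (λ i → trans (φ-- x y i) (orbit-cong (λ _ → refl) (λ t → x-y≡Lv _) n i)))
        (φ-laplacian v))

    periodic-% : ∀ (u : ℕ → ℤ) → (∀ t → u (t ℕ.+ n) ≡ u t) → ∀ a → u (a % n) ≡ u a
    periodic-% u u-per a = trans (sym (shifts (a % n) (a ℕ./ n))) (cong u (sym (ℕ.m≡m%n+[m/n]*n a n)))
      where
      shifts : ∀ b q → u (b ℕ.+ q ℕ.* n) ≡ u b
      shifts b zero    = cong u (ℕₚ.+-identityʳ b)
      shifts b (suc q) = trans (cong u (reorder b n q)) (trans (u-per (b ℕ.+ q ℕ.* n)) (shifts b q))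
        where
        reorder : ∀ b n q → b ℕ.+ (n ℕ.+ q ℕ.* n) ≡ b ℕ.+ q ℕ.* n ℕ.+ n
        reorder = solve-∀

    residue-∸S+S : ∀ (i : Fin n) → residue (toℕ i ℕ.+ (n ∸ S) ℕ.+ S) ≡ i
    residue-∸S+S i = trans (cong residue (trans (ℕₚ.+-assoc (toℕ i) (n ∸ S) S) (cong (toℕ i ℕ.+_) (ℕₚ.m∸n+n≡m S≤n))))
                           (trans (residue-+n (toℕ i)) (residue-toℕ i))

    potential : (ℕ → ℤ) → Vec (suc n)
    potential u zero    = + 0
    potential u (suc i) = u (toℕ i)

    laplacian-potential : ∀ (u Y : ℕ → ℤ) → (∀ t → residual u t + Y t ≡ + 0) → (∀ t → u (t ℕ.+ n) ≡ u t) →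
      ∀ i → (L ·ᵛ potential u) (suc i) ≡ Y (toℕ i ℕ.+ (n ∸ S))
    laplacian-potential u Y solves u-per i = begin
      (L ·ᵛ v) (suc i)                      ≡⟨ cong (λ z → (L ·ᵛ v) (suc z)) (sym (residue-∸S+S i)) ⟩
      (L ·ᵛ v) (suc (residue (t ℕ.+ S)))    ≡⟨ laplacian-residual v t ⟩
      - residual (relative v) t             ≡⟨ cong -_ (residual-cong relative≡u t) ⟩
      - residual u t                        ≡⟨ solve 2 (λ r y → :- r := y :- (r :+ y)) refl (residual u t) (Y t) ⟩
      Y t - (residual u t + Y t)            ≡⟨ cong (_-_ (Y t)) (solves t) ⟩
      Y t - + 0                             ≡⟨ ℤₚ.+-identityʳ _ ⟩
      Y t ∎
      where
      open ≡-Reasoning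
      v : Vec (suc n)
      v = potential u
      t : ℕ
      t = toℕ i ℕ.+ (n ∸ S)
      relative≡u : ∀ a → relative v a ≡ u a
      relative≡u a = trans (ℤₚ.+-identityʳ _) (trans (cong u (toℕ-residue a)) (periodic-% u u-per a))

    φ-injective : ∀ x y → sumFin x ≡ + 0 → sumFin y ≡ + 0 → ImRel 𝒩 (φ x) (φ y) → ImRel L x y
    φ-injective x y Σx≡0 Σy≡0 (w , φx-φy≡𝒩w) = v , difference
      where
      Y : ℕ → ℤ
      Y t = forcing x t - forcing y t
      w₀ : Vec (suc m)
      w₀ j = - w j
      fixed : ∀ i → orbit w₀ Y n i ≡ w₀ i
      fixed i = begin
        orbit w₀ Y n i
          ≡⟨ orbit-cong (λ j → sym (ℤₚ.+-identityʳ (w₀ j))) (λ t → sym (ℤₚ.+-identityˡ (Y t))) n i ⟩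
        orbit (λ j → w₀ j + 𝟎 j) (λ t → + 0 + Y t) n i
          ≡⟨ orbit-+ w₀ 𝟎 (λ _ → + 0) Y n i ⟩
        orbit w₀ (λ _ → + 0) n i + orbit 𝟎 Y n i
          ≡⟨ cong₂ _+_ (trans (orbit-unforced w₀ n i) (·ᵛ-neg (𝒜 ^ᴹ n) w i))
                       (trans (sym (φ-- x y i)) (trans (φx-φy≡𝒩w i) (𝒩-·ᵛ w i))) ⟩
        - ((𝒜 ^ᴹ n) ·ᵛ w) i + (((𝒜 ^ᴹ n) ·ᵛ w) i - w i)
          ≡⟨ solve 2 (λ p q → :- p :+ (p :- q) := :- q) refl (((𝒜 ^ᴹ n) ·ᵛ w) i) (w i) ⟩
        w₀ i ∎
        where open ≡-Reasoning
      u : ℕ → ℤ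
      u = orbitSeq w₀ Y
      u-periodic : ∀ t → u (t ℕ.+ n) ≡ u t
      u-periodic t = orbit-periodic w₀ Y n (λ t → cong₂ _-_ (forcing-periodic x t) (forcing-periodic y t)) fixed t zero
      v : Vec (suc n)
      v = potential u
      tail : ∀ i → x (suc i) - y (suc i) ≡ (L ·ᵛ v) (suc i)
      tail i = sym (trans (laplacian-potential u Y (orbitSeq-solves w₀ Y) u-periodic i)
                          (cong (λ z → x (suc z) - y (suc z)) (residue-∸S+S i)))
      difference : ∀ i → x i - y i ≡ (L ·ᵛ v) i
      difference (suc i) = tail i
      difference zero    =
        sum≡0-head x y (L ·ᵛ v) Σx≡0 Σy≡0 (sum-laplacian-·ᵛ (cone C) (cone-symmetric C circulant-symmetric) v) tail

    padded : Vec (suc m) → ℕ → ℤ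
    padded w t with t ℕ.<? n | t ∸ n ℕ.<? suc m
    ... | yes _ | _         = + 0
    ... | no  _ | yes j<1+m = w (fromℕ< j<1+m)
    ... | no  _ | no  _     = + 0

    padded-start : ∀ w t → t < n → padded w t ≡ + 0
    padded-start w t t<n with t ℕ.<? n
    ... | yes _   = refl
    ... | no  t≮n = ⊥-elim (t≮n t<n)

    padded-window : ∀ w j → window (padded w) n j ≡ w j
    padded-window w j with n ℕ.+ toℕ j ℕ.<? n | n ℕ.+ toℕ j ∸ n ℕ.<? suc m
    ... | yes n+j<n | _     = ⊥-elim (ℕₚ.<-irrefl refl (ℕₚ.<-≤-trans n+j<n (ℕₚ.m≤m+n n (toℕ j))))
    ... | no  _     | yes p = cong w (Finₚ.toℕ-injective (trans (Finₚ.toℕ-fromℕ< p) (ℕₚ.m+n∸m≡n n (toℕ j))))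
    ... | no  _     | no  p = ⊥-elim (p (subst (_< suc m) (sym (ℕₚ.m+n∸m≡n n (toℕ j))) (Finₚ.toℕ<n j)))

    time : Fin n → ℕ
    time i = toℕ (residue (toℕ i ℕ.+ (n ∸ S)))

    time-residue : ∀ t → t < n → time (residue (t ℕ.+ S)) ≡ t
    time-residue t t<n = begin
      toℕ (residue (toℕ (residue (t ℕ.+ S)) ℕ.+ (n ∸ S))) ≡⟨ cong toℕ (residue-+ (t ℕ.+ S) (n ∸ S)) ⟩
      toℕ (residue (t ℕ.+ S ℕ.+ (n ∸ S)))
        ≡⟨ cong (λ z → toℕ (residue z)) (trans (ℕₚ.+-assoc t S (n ∸ S)) (cong (t ℕ.+_) (ℕₚ.m+[n∸m]≡n S≤n))) ⟩
      toℕ (residue (t ℕ.+ n))                            ≡⟨ cong toℕ (residue-+n t) ⟩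
      toℕ (residue t)                                    ≡⟨ toℕ-residue t ⟩
      t % n                                              ≡⟨ ℕ.m<n⇒m%n≡m t<n ⟩
      t ∎
      where open ≡-Reasoning

    preimage : Vec (suc m) → Vec (suc n)
    preimage w zero    = - sumFin (λ i → - residual (padded w) (time i))
    preimage w (suc i) = - residual (padded w) (time i)

    preimage-sum : ∀ w → sumFin (preimage w) ≡ + 0
    preimage-sum w = ℤₚ.+-inverseˡ (sumFin (λ i → - residual (padded w) (time i)))

    φ-preimage : ∀ w i → φ (preimage w) i ≡ w i
    φ-preimage w i = begin
      φ (preimage w) i                                   ≡⟨ orbit-solution (padded w) (forcing (preimage w)) solves i ⟩
      window (padded w) n i - ((𝒜 ^ᴹ n) ·ᵛ window (padded w) 0) i
        ≡⟨ cong₂ _-_ (padded-window w i) (trans (·ᵛ-cong (𝒜 ^ᴹ n) start i) (·ᵛ-zero (𝒜 ^ᴹ n) i)) ⟩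
      w i - + 0                                          ≡⟨ ℤₚ.+-identityʳ (w i) ⟩
      w i ∎
      where
      open ≡-Reasoning
      solves : ∀ t → t < n → residual (padded w) t + forcing (preimage w) t ≡ + 0
      solves t t<n = trans (cong (λ z → residual (padded w) t + - residual (padded w) z) (time-residue t t<n))
                           (ℤₚ.+-inverseʳ (residual (padded w) t))
      start : ∀ j → window (padded w) 0 j ≡ + 0
      start j = padded-start w (toℕ j) (ℕₚ.<-trans (Finₚ.toℕ<n j) 2S<n)

    jacobian≅coker : JacIsoCoker (cone (circulant n s)) ((circCompanion s S ^ᴹ n) -ᴹ identity)
    jacobian≅coker = record
      { f      = λ x _ → φ x
      ; f-in   = λ _ _ → tt
      ; f-cong = λ x y _ _ → φ-cong x y
      ; f-hom  = λ x y _ _ _ → ImRel-reflexive 𝒩 (φ-+ x y)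
      ; f-inj  = λ x y x-torsion y-torsion → φ-injective x y (torsion⇒sum≡0 x x-torsion) (torsion⇒sum≡0 y y-torsion)
      ; f-surj = λ w _ → preimage w , sum≡0⇒IsTorsion (preimage w) (preimage-sum w) , ImRel-reflexive 𝒩 (φ-preimage w)
      }
      where
      open ConeTorsion C circulant-symmetric using (sum≡0⇒IsTorsion)
      torsion⇒sum≡0 : ∀ x → IsTorsion L x → sumFin x ≡ + 0
      torsion⇒sum≡0 = IsTorsion⇒sum≡0 (cone C) (cone-symmetric C circulant-symmetric)

  module _ {k} (s : Fin (suc k) → ℕ) (s-increasing : ∀ i j → i F.< j → s i < s j) where

    ≤-last : ∀ l → s l ≤ s (fromℕ k)
    ≤-last l with l Finₚ.≟ fromℕ k
    ... | yes refl   = ℕₚ.≤-refl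
    ... | no  l≢top = ℕₚ.<⇒≤ (s-increasing l (fromℕ k) (Finₚ.≤∧≢⇒< (Finₚ.≤fromℕ l) l≢top))

    ≡-last⇒last : ∀ l → s l ≡ s (fromℕ k) → l ≡ fromℕ k
    ≡-last⇒last l s≡ with l Finₚ.≟ fromℕ k
    ... | yes l≡top = l≡top
    ... | no  l≢top = ⊥-elim (ℕₚ.<-irrefl s≡ (s-increasing l (fromℕ k) (Finₚ.≤∧≢⇒< (Finₚ.≤fromℕ l) l≢top)))

open import Defs
open import Data.Nat using (ℕ; suc; _≤_; _<_; _*_)
open import Data.Fin using (Fin; zero; fromℕ)
open import Data.Fin as F using ()
open import Data.Nat using (zero)
import Data.Nat.Properties as ℕₚ
open import Data.Empty using (⊥-elim)
open import Relation.Binary.PropositionalEquality using (refl)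
open CirculantConeJacobian using (module CirculantCone; ≤-last; ≡-last⇒last)

theorem3 : (k n : ℕ) (s : Fin (suc k) → ℕ) →
    1 ≤ s zero →
    (∀ (i j : Fin (suc k)) → i F.< j → s i < s j) →
    2 * s (fromℕ k) < n →
    JacIsoCoker (cone (circulant n s))
      ((circCompanion s (s (fromℕ k)) ^ᴹ n) -ᴹ identity)
theorem3 k (suc n') s 1≤s₀ s-increasing 2sₖ<n
  with s (fromℕ k) in sₖ≡ | ≤-last s s-increasing | ≡-last⇒last s s-increasing
... | zero   | s≤0 | _ = ⊥-elim (ℕₚ.<-irrefl refl (ℕₚ.<-≤-trans 1≤s₀ (s≤0 zero)))
... | suc S' | s≤S | top-unique =
  CirculantCone.jacobian≅coker n' s S' s≤S (fromℕ k) sₖ≡ top-unique 2sₖ<n
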